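{- Let $n\ge 2$. If $P,P'\in\mathcal{D}_n$ are Dyck paths such that $P'$ is obtained from $P$ by replacing a valley $\mathsf{E}\mathsf{N}$ (two consecutive steps) by a peak $\mathsf{N}\mathsf{E}$, then $\mathsf{traj}(P)-\mathsf{traj}(P')=\pm1$.
   Context: A Dyck path of size $n$ is a lattice path in $\mathbb{Z}^2$ from $(0,0)$ to $(n,n)$ using steps $\mathsf{N}=(0,1)$ and $\mathsf{E}=(1,0)$ that never goes below $y=x$; $\mathcal{D}_n$ is the set of such paths. A peak is an occurrence of consecutive steps $\mathsf{N}\mathsf{E}$, a valley an occurrence of $\mathsf{E}\mathsf{N}$. For a Dyck path $P$, $-P$ is its reflection over $y=x$. For $P,Q\in\mathcal{D}_n$, the grid polygon associated with $(P,Q)$ is the region enclosed by $P$ and $-Q$; its boundary consists of the $4n$ unit steps of $P$ and $-Q$. From the midpoint of any boundary step, emit a light beam into the interior making a $45^\circ$ angle with that step; it travels straight until it reaches the midpoint of another boundary step (meeting it at $45^\circ$). This defines a permutation of the $4n$ boundary steps; $\mathsf{traj}(P,Q)$ is its number of cycles. For $P\in\mathcal{D}_n$, $\mathsf{traj}(P)=\mathsf{traj}(P,\mathsf{N}^n\mathsf{E}^n)$. -}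

module Defs where

open import Data.Nat.Base using (ℕ; zero; suc; _+_; _*_; _∸_; _<ᵇ_; _≤ᵇ_; _≡ᵇ_)
open import Data.Nat using (_≤_)
open import Data.Bool.Base using (Bool; true; false; if_then_else_; not; _∧_; _∨_; _xor_)
open import Data.List.Base using (List; []; _∷_; _++_; length; replicate; map; filter; upTo; concatMap)
open import Data.Bool.ListAction using (and)
open import Data.Product.Base using (_×_; _,_; Σ; ∃; ∃₂)
open import Data.Empty using (⊥)
open import Data.Unit.Base using (⊤)
open import Relation.Binary.PropositionalEquality using (_≡_)
open import Relation.Nullary.Decidable.Core using (T?)

data Step : Set where
  N E : Step          -- N = (0,1), E = (1,0)

Path : Set
Path = List Step

-- a path (read from height h = #N - #E) that never goes below y = x
-- and ends on y = x
DyckFrom : ℕ → Path → Set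
DyckFrom h       []      = h ≡ 0
DyckFrom h       (N ∷ w) = DyckFrom (suc h) w
DyckFrom zero    (E ∷ w) = ⊥
DyckFrom (suc h) (E ∷ w) = DyckFrom h w

IsDyck : ℕ → Path → Set
IsDyck n P = (length P ≡ n + n) × DyckFrom 0 P

ValleyToPeak : Path → Path → Set
ValleyToPeak P P' =
  Σ Path λ u → Σ Path λ v → (P ≡ u ++ E ∷ N ∷ v) × (P' ≡ u ++ N ∷ E ∷ v)

reflect : Path → Path
reflect = map sw
  where
  sw : Step → Step
  sw N = E
  sw E = N

-- Column heights: for a path from (0,0) to (n,n), (heights P) lists, for
-- each column i (x ∈ [i,i+1]), the y-coordinate of the E step of P in
-- that column.

heightsFrom : ℕ → Path → List ℕ
heightsFrom h []      = []
heightsFrom h (N ∷ w) = heightsFrom (suc h) w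
heightsFrom h (E ∷ w) = h ∷ heightsFrom h w

heights : Path → List ℕ
heights = heightsFrom 0

nth : List ℕ → ℕ → ℕ
nth []       _       = 0
nth (x ∷ xs) zero    = x
nth (x ∷ xs) (suc i) = nth xs i

-- The grid polygon of (P , Q), P Q ∈ 𝒟ₙ: the region between the upper
-- path P and the lower path -Q.  Cell (i , j) is the unit square
-- [i,i+1] × [j,j+1]; it is inside iff i < n and lo(i) ≤ j < up(i).

module Polygon (n : ℕ) (P Q : Path) where

  up lo : ℕ → ℕ
  up i = nth (heights P) i
  lo i = nth (heights (reflect Q)) i

  inside : ℕ → ℕ → Bool
  inside i j = (i <ᵇ n) ∧ (lo i ≤ᵇ j) ∧ (j <ᵇ up i)

  insideBelow : ℕ → ℕ → Bool
  insideBelow i zero    = false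
  insideBelow i (suc j) = inside i j

  insideLeft : ℕ → ℕ → Bool
  insideLeft zero    j = false
  insideLeft (suc i) j = inside i j

  -- unit edges of the grid:
  --   hor i j : segment from (i , j) to (i+1 , j)
  --   ver i j : segment from (i , j) to (i , j+1)
  data Edge : Set where
    hor ver : ℕ → ℕ → Edge

  isBoundary : Edge → Bool
  isBoundary (hor i j) = inside i j xor insideBelow i j
  isBoundary (ver i j) = inside i j xor insideLeft i j

  -- all boundary steps (the 4n unit steps of P and -Q); the polygon is
  -- contained in [0,n] × [0,n]
  boundary : List Edge
  boundary =
    filter (λ e → T? (isBoundary e))
      (concatMap (λ i → map (hor i) (upTo (suc n))) (upTo n)
       ++ concatMap (λ i → map (ver i) (upTo n)) (upTo (suc n)))

  -- A beam is in a cell, heading in direction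
  -- (dx , dy) ∈ {±1}² (true = +1), having entered that cell through a
  -- horizontal side (hz = true) or a vertical side (hz = false).  It crosses
  -- the cell from the midpoint of one side to the midpoint of an adjacent
  -- side, and stops at the first boundary edge it reaches.
  record Beam : Set where
    constructor beam
    field
      ci cj : ℕ
      dx dy : Bool
      hz    : Bool

  data Next : Set where
    hit  : Edge → Next
    move : Beam → Next

  advance : Beam → Next
  advance (beam i j true  dy true) =
    if inside (suc i) j then move (beam (suc i) j true dy false)
                        else hit (ver (suc i) j)
  advance (beam zero j false dy true) = hit (ver zero j)
  advance (beam (suc i) j false dy true) =
    if inside i j then move (beam i j false dy false)
                  else hit (ver (suc i) j)
  advance (beam i j dx true false) =
    if inside i (suc j) then move (beam i (suc j) dx true true)
                        else hit (hor i (suc j))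
  advance (beam i zero dx false false) = hit (hor i zero)
  advance (beam i (suc j) dx false false) =
    if inside i j then move (beam i j dx false true)
                  else hit (hor i (suc j))

  -- follow a beam (a straight beam crosses at most 2n cells; the fuel
  -- below is more than enough, so the default is never reached)
  travel : ℕ → Edge → Beam → Edge
  travel zero       def b = def
  travel (suc fuel) def b with advance b
  ... | hit e  = e
  ... | move b' = travel fuel def b'

  even : ℕ → Bool
  even zero    = true
  even (suc k) = not (even k)

  -- the beam emitted into the interior from the midpoint of a boundary
  -- edge, at 45° to it.  Convention for which of the two 45° directions
  -- is used (checkerboard convention):
  --   hor i j : horizontal component  +1 iff i + j even
  --   ver i j : vertical component    +1 iff i + j odd
  emit : Edge → Beam
  emit (hor i j) =
    if inside i j then beam i j (even (i + j)) true true
                  else beam i (j ∸ 1) (even (i + j)) false true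
  emit (ver i j) =
    if inside i j then beam i j true (not (even (i + j))) false
                  else beam (i ∸ 1) j false (not (even (i + j))) false

  σ : Edge → Edge
  σ e = travel (4 * (suc n) * (suc n)) e (emit e)

  iter : ℕ → Edge → Edge
  iter zero    e = e
  iter (suc k) e = σ (iter k e)

  _≤ᴱ_ : Edge → Edge → Bool
  hor i j ≤ᴱ hor k l = (i <ᵇ k) ∨ ((i ≡ᵇ k) ∧ (j ≤ᵇ l))
  hor i j ≤ᴱ ver k l = true
  ver i j ≤ᴱ hor k l = false
  ver i j ≤ᴱ ver k l = (i <ᵇ k) ∨ ((i ≡ᵇ k) ∧ (j ≤ᵇ l))

  cycleRep : Edge → Bool
  cycleRep e = and (map (λ m → e ≤ᴱ iter m e) (upTo (length boundary)))

  numCycles : ℕ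
  numCycles = length (filter (λ e → T? (cycleRep e)) boundary)

traj₂ : ℕ → Path → Path → ℕ
traj₂ n P Q = Polygon.numCycles n P Q

traj : ℕ → Path → ℕ
traj n P = traj₂ n P (replicate n N ++ replicate n E)

{-# OPTIONS --safe #-}

-- A beam's direction is determined by the colour of its cell in the checkerboard and by the side it
-- entered through, so beams can be retraced backwards and σ permutes the boundary steps; traj counts
-- its cycles. Turning the valley E N into the peak N E adds one cell C to the polygon: the sides h₀
-- below and v₁ right of C leave the boundary, the sides h₁ above and v₀ left of C join it. Beams
-- avoiding C are unchanged, and the two beams that ended at h₀ and v₁ now run through C. Cutting h₀
-- and v₁ out of the cycles of the old permutation, and h₁ and v₀ out of those of the new one, leaves
-- two permutations of the same set that differ by a transposition, which changes the number of
-- cycles by exactly one.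

module Submission where

open import Defs
open import Data.Bool.Base using (Bool; true; false; not; T; _∧_; _∨_; _xor_; if_then_else_)
open import Data.Bool.ListAction using (and; all)
open import Data.Bool.Properties
  using (∧-identityʳ; ∧-zeroʳ; not-involutive; not-injective; xor-annihilates-not; xor-comm; T-≡; T-∧; T-∨)
open import Data.Empty using (⊥-elim)
open import Data.Fin.Base using (toℕ; fromℕ<)
open import Data.Fin.Properties using (pigeonhole; toℕ<n; toℕ-fromℕ<; any?)
open import Data.List.Base
  using (List; []; _∷_; _++_; length; replicate; map; filter; upTo; lookup; concatMap; cartesianProductWith)
open import Data.List.Extrema using (min; min≤xs; argmin-sel)
open import Data.List.Membership.Propositional using (_∈_; _∉_; find; lose)
open import Data.List.Membership.Propositional.Properties
  using (∈-filter⁺; ∈-filter⁻; ∈-upTo⁺; ∈-upTo⁻; ∈-map⁺; ∈-map⁻; ∈-++⁺ˡ; ∈-++⁺ʳ; ∈-++⁻;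
         ∈-cartesianProductWith⁺; ∈-cartesianProductWith⁻)
open import Data.List.Membership.Propositional.Properties.WithK using (unique∧set⇒bag)
open import Data.List.Properties using (length-++; length-map; map-cong)
open import Data.List.Relation.Binary.BagAndSetEquality using (∼bag⇒↭)
open import Data.List.Relation.Binary.Permutation.Propositional using (_↭_; ↭-sym)
open import Data.List.Relation.Binary.Permutation.Propositional.Properties using (↭-length; filter-↭; ∈-resp-↭)
open import Data.List.Relation.Unary.All as All using (All; []; _∷_)
open import Data.List.Relation.Unary.All.Properties using (all⁺; all⁻)
open import Data.List.Relation.Unary.Any as Any using (here; there; index)
open import Data.List.Relation.Unary.Any.Properties using (lookup-index)
open import Data.List.Relation.Unary.Unique.Propositional using (Unique; []; _∷_)
import Data.List.Relation.Unary.Unique.Propositional.Properties as Unique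
open import Data.Maybe.Base using (Maybe; just; nothing)
open import Data.Nat.Base
  using (ℕ; zero; suc; _+_; _*_; _∸_; _<_; _≤_; z≤n; s≤s; _<ᵇ_; _≤ᵇ_; _≡ᵇ_)
open import Data.Nat.DivMod using (_%_; _/_; m≡m%n+[m/n]*n; m%n<n)
open import Data.Nat.Properties
  using (_≟_; _<?_; +-suc; +-comm; +-identityʳ; +-mono-≤; +-mono-<; +-monoˡ-<; +-monoʳ-<; +-monoʳ-≤;
         ≤-refl; ≤-reflexive; ≤-trans; ≤-antisym; ≤-total; ≤-pred; <-trans; <-≤-trans; <-irrefl; <-asym; <-cmp;
         <⇒≤; n<1+n; n≤1+n; m≤m+n; m≤n+m; m≤m*n; m∸n+n≡m; ∸-monoʳ-<; m≤n⇒∃[o]m+o≡n; n≤0⇒n≡0;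
         suc-injective; <ᵇ⇒<; <⇒<ᵇ; ≡ᵇ⇒≡; ≡⇒≡ᵇ; ≤ᵇ⇒≤; ≤⇒≤ᵇ)
open import Data.Product.Base using (_×_; _,_; ∃; proj₁; proj₂)
open import Data.Product.Properties using (≡-dec)
open import Data.Sum.Base using (_⊎_; inj₁; inj₂; [_,_]; [_,_]′)
open import Function.Base using (_∘_; id)
open import Function.Bundles using (_⇔_; mk⇔; Equivalence)
open import Relation.Binary.Bundles using (TotalOrder)
open import Relation.Binary.Construct.Closure.ReflexiveTransitive using (Star; ε; _◅_; _◅◅_; reverse)
import Relation.Binary.Construct.Closure.ReflexiveTransitive as Star
open import Relation.Binary.Definitions using (DecidableEquality; tri<; tri≈; tri>)
open import Relation.Binary.PropositionalEquality
  using (_≡_; _≢_; refl; sym; trans; cong; cong₂; subst; subst₂; ≢-sym; isEquivalence; module ≡-Reasoning)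
open import Relation.Binary.Structures using (IsTotalOrder)
open import Relation.Nullary using (¬_; Dec; yes; no)
open import Relation.Nullary.Decidable using (¬?; map′; _×-dec_; dec-true; dec-false)
open import Relation.Nullary.Decidable.Core using (T?)

-- Cycles of permutations of a finite list

_~₁_ : ℕ → ℕ → Set
m ~₁ n = m ≡ suc n ⊎ suc m ≡ n

~₁-sym : ∀ {m n} → m ~₁ n → n ~₁ m
~₁-sym (inj₁ e) = inj₂ (sym e)
~₁-sym (inj₂ e) = inj₁ (sym e)

~₁-suc : ∀ {m n} → m ~₁ n → suc m ~₁ suc n
~₁-suc (inj₁ e) = inj₁ (cong suc e)
~₁-suc (inj₂ e) = inj₂ (cong suc e)

T-injective : ∀ {a b} → (T a → T b) → (T b → T a) → a ≡ b
T-injective {false} {false} _ _ = refl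
T-injective {false} {true}  _ g = ⊥-elim (g _)
T-injective {true}  {false} f _ = ⊥-elim (f _)
T-injective {true}  {true}  _ _ = refl

module Cycles {A : Set} (_≟_ : DecidableEquality A) (_⊑_ : A → A → Bool)
  (⊑-isTotalOrder : IsTotalOrder _≡_ (λ x y → T (x ⊑ y))) where

  private
    module ⊑ = IsTotalOrder ⊑-isTotalOrder

    ⊑-refl : ∀ x → T (x ⊑ x)
    ⊑-refl x = ⊑.reflexive refl

    ⊑-totalOrder : TotalOrder _ _ _
    ⊑-totalOrder = record { isTotalOrder = ⊑-isTotalOrder }

  iter : (A → A) → ℕ → A → A
  iter f zero    x = x
  iter f (suc m) x = f (iter f m x)

  -- x precedes its first L iterates; for L at least the length of its cycle, x is the least element of the cycle
  isCycleRep : (A → A) → ℕ → A → Bool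
  isCycleRep f L x = all (λ m → x ⊑ iter f m x) (upTo L)

  count : (A → Bool) → List A → ℕ
  count p xs = length (filter (T? ∘ p) xs)

  cycles : (A → A) → List A → ℕ
  cycles f B = count (isCycleRep f (length B)) B

  infixl 5 _─_
  _─_ : List A → A → List A
  B ─ x = filter (λ y → ¬? (y ≟ x)) B

  ∈-─⁺ : ∀ {B x z} → z ∈ B → z ≢ x → z ∈ B ─ x
  ∈-─⁺ = ∈-filter⁺ _

  ∈-─⁻ : ∀ B {x z} → z ∈ B ─ x → z ∈ B × z ≢ x
  ∈-─⁻ B = ∈-filter⁻ _ {xs = B}

  ─-unique : ∀ {B x} → Unique B → Unique (B ─ x)
  ─-unique = Unique.filter⁺ _

  unique-↭ : ∀ {B B′ : List A} → Unique B → Unique B′ →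
             (∀ {z} → z ∈ B → z ∈ B′) → (∀ {z} → z ∈ B′ → z ∈ B) → B ↭ B′
  unique-↭ u u′ B⊆B′ B′⊆B = ∼bag⇒↭ (unique∧set⇒bag u u′ (mk⇔ B⊆B′ B′⊆B))

  ↭-─ : ∀ {B x} → Unique B → x ∈ B → B ↭ x ∷ (B ─ x)
  ↭-─ {B} {x} u x∈B =
    unique-↭ u (All.tabulate (≢-sym ∘ proj₂ ∘ ∈-─⁻ B) ∷ ─-unique u) split join
    where
    split : ∀ {z} → z ∈ B → z ∈ x ∷ (B ─ x)
    split {z} z∈B with z ≟ x
    ... | yes refl = here refl
    ... | no  z≢x  = there (∈-─⁺ z∈B z≢x)
    join : ∀ {z} → z ∈ x ∷ (B ─ x) → z ∈ B
    join (here refl) = x∈B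
    join (there z∈)  = proj₁ (∈-─⁻ B z∈)

  length-─ : ∀ {B x} → Unique B → x ∈ B → length B ≡ suc (length (B ─ x))
  length-─ u x∈B = ↭-length (↭-─ u x∈B)

  count-↭ : ∀ p {B B′} → B ↭ B′ → count p B ≡ count p B′
  count-↭ p = ↭-length ∘ filter-↭ (T? ∘ p)

  count-∷-true : ∀ p {x xs} → p x ≡ true → count p (x ∷ xs) ≡ suc (count p xs)
  count-∷-true p px rewrite px = refl

  count-∷-false : ∀ p {x xs} → p x ≡ false → count p (x ∷ xs) ≡ count p xs
  count-∷-false p px rewrite px = refl

  count-─-true : ∀ p {B x} → Unique B → x ∈ B → p x ≡ true → count p B ≡ suc (count p (B ─ x))
  count-─-true p u x∈B px = trans (count-↭ p (↭-─ u x∈B)) (count-∷-true p px)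

  count-─-false : ∀ p {B x} → Unique B → x ∈ B → p x ≡ false → count p B ≡ count p (B ─ x)
  count-─-false p u x∈B px = trans (count-↭ p (↭-─ u x∈B)) (count-∷-false p px)

  count-cong : ∀ {p q} B → (∀ {y} → y ∈ B → p y ≡ q y) → count p B ≡ count q B
  count-cong {p} {q} [] _ = refl
  count-cong {p} {q} (y ∷ B) p≗q with p y | q y | p≗q (here refl) | count-cong B (p≗q ∘ there)
  ... | true  | .true  | refl | ih = cong suc ih
  ... | false | .false | refl | ih = ih

  count-flip : ∀ {p q B y} → Unique B → y ∈ B → p y ≡ false → q y ≡ true →
               (∀ {z} → z ∈ B → z ≢ y → p z ≡ q z) → count q B ≡ suc (count p B)
  count-flip {p} {q} {B} u y∈B py qy p≗q = trans (count-─-true q u y∈B qy) (cong suc (begin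
    count q (B ─ _)  ≡⟨ count-cong (B ─ _) (λ z∈ → sym (p≗q (proj₁ (∈-─⁻ B z∈)) (proj₂ (∈-─⁻ B z∈)))) ⟩
    count p (B ─ _)  ≡⟨ count-─-false p u y∈B py ⟨
    count p B        ∎))
    where open ≡-Reasoning

  record Permutes (f : A → A) (B : List A) : Set where
    field
      closed    : ∀ {x} → x ∈ B → f x ∈ B
      injective : ∀ {x y} → x ∈ B → y ∈ B → f x ≡ f y → x ≡ y
  open Permutes public

  Reaches : (A → A) → A → A → Set
  Reaches f x y = ∃ λ m → iter f m x ≡ y

  OrbitMin : (A → A) → A → Set
  OrbitMin f x = ∀ y → Reaches f x y → T (x ⊑ y)

  iter-+ : ∀ f m k x → iter f (m + k) x ≡ iter f m (iter f k x)
  iter-+ f zero    k x = refl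
  iter-+ f (suc m) k x = cong f (iter-+ f m k x)

  iter-sucʳ : ∀ f m x → iter f (suc m) x ≡ iter f m (f x)
  iter-sucʳ f zero    x = refl
  iter-sucʳ f (suc m) x = cong f (iter-sucʳ f m x)

  reaches-refl : ∀ {f x} → Reaches f x x
  reaches-refl = 0 , refl

  reaches-step : ∀ {f x} → Reaches f x (f x)
  reaches-step = 1 , refl

  reaches-trans : ∀ {f x y z} → Reaches f x y → Reaches f y z → Reaches f x z
  reaches-trans {f} {x} (m , refl) (k , refl) = k + m , iter-+ f k m x

  isCycleRep-complete : ∀ {f x} L → OrbitMin f x → T (isCycleRep f L x)
  isCycleRep-complete L min = all⁻ _ {upTo L} (All.tabulate (λ {m} _ → min _ (m , refl)))

  iter-periodic : ∀ {f x k} → iter f k x ≡ x → ∀ c → iter f (c * k) x ≡ x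
  iter-periodic                 fᵏx≡x zero    = refl
  iter-periodic {f} {x} {k} fᵏx≡x (suc c) =
    trans (iter-+ f k (c * k) x) (trans (cong (iter f k) (iter-periodic fᵏx≡x c)) fᵏx≡x)

  module _ {f B} (perm : Permutes f B) where

    iter-∈ : ∀ m {x} → x ∈ B → iter f m x ∈ B
    iter-∈ zero    x∈B = x∈B
    iter-∈ (suc m) x∈B = closed perm (iter-∈ m x∈B)

    iter-injective : ∀ m {x y} → x ∈ B → y ∈ B → iter f m x ≡ iter f m y → x ≡ y
    iter-injective zero    _   _   eq = eq
    iter-injective (suc m) x∈B y∈B eq =
      iter-injective m x∈B y∈B (injective perm (iter-∈ m x∈B) (iter-∈ m y∈B) eq)

    -- pigeonhole on x, f x, …, f^|B| x
    period : ∀ {x} → x ∈ B → ∃ λ k → suc k ≤ length B × iter f (suc k) x ≡ x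
    period {x} x∈B
      with i , j , i<j , same-index ← pigeonhole (n<1+n (length B)) (λ i → index (iter-∈ (toℕ i) x∈B))
      with k , i+k≡j ← m≤n⇒∃[o]m+o≡n i<j =
      k , ≤-trans (s≤s (m≤n+m k (toℕ i))) (subst (_≤ length B) (sym i+k≡j) (≤-pred (toℕ<n j))) ,
      sym (iter-injective (toℕ i) x∈B (iter-∈ (suc k) x∈B) (begin
        iter f (toℕ i) x                   ≡⟨ lookup-index (iter-∈ (toℕ i) x∈B) ⟩
        lookup B _                         ≡⟨ cong (lookup B) same-index ⟩
        lookup B _                         ≡⟨ sym (lookup-index (iter-∈ (toℕ j) x∈B)) ⟩
        iter f (toℕ j) x                   ≡⟨ cong (λ m → iter f m x) (sym i+k≡j) ⟩
        iter f (suc (toℕ i + k)) x         ≡⟨ cong (λ m → iter f m x) (sym (+-suc (toℕ i) k)) ⟩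
        iter f (toℕ i + suc k) x           ≡⟨ iter-+ f (toℕ i) (suc k) x ⟩
        iter f (toℕ i) (iter f (suc k) x)  ∎))
      where
      open ≡-Reasoning

    preimage : ∀ {y} → y ∈ B → ∃ λ x → x ∈ B × f x ≡ y
    preimage {y} y∈B with k , _ , fᵏ⁺¹y≡y ← period y∈B = iter f k y , iter-∈ k y∈B , fᵏ⁺¹y≡y

    reaches-bounded : ∀ {x y} → x ∈ B → Reaches f x y → ∃ λ m → m < length B × iter f m x ≡ y
    reaches-bounded {x} x∈B (m , refl) with k , k<L , fᵏx≡x ← period x∈B =
      m % suc k , <-≤-trans (m%n<n m (suc k)) k<L , (begin
        iter f (m % suc k) x                                 ≡⟨ cong (iter f (m % suc k)) (iter-periodic {f} fᵏx≡x (m / suc k)) ⟨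
        iter f (m % suc k) (iter f (m / suc k * suc k) x)    ≡⟨ iter-+ f (m % suc k) (m / suc k * suc k) x ⟨
        iter f (m % suc k + m / suc k * suc k) x             ≡⟨ cong (λ t → iter f t x) (m≡m%n+[m/n]*n m (suc k)) ⟨
        iter f m x                                           ∎)
      where open ≡-Reasoning

    reaches-sym : ∀ {x y} → x ∈ B → Reaches f x y → Reaches f y x
    reaches-sym {x} x∈B (m , refl) with k , _ , fᵏx≡x ← period x∈B =
      m * suc k ∸ m , (begin
        iter f (m * suc k ∸ m) (iter f m x)  ≡⟨ iter-+ f (m * suc k ∸ m) m x ⟨
        iter f (m * suc k ∸ m + m) x         ≡⟨ cong (λ t → iter f t x) (m∸n+n≡m (m≤m*n m (suc k))) ⟩
        iter f (m * suc k) x                 ≡⟨ iter-periodic {f} fᵏx≡x m ⟩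
        x                                    ∎)
      where open ≡-Reasoning

    reaches? : ∀ {x} → x ∈ B → ∀ y → Dec (Reaches f x y)
    reaches? {x} x∈B y = map′ (λ (i , e) → toℕ i , e) bounded (any? (λ i → iter f (toℕ i) x ≟ y))
      where
      bounded : Reaches f x y → ∃ λ i → iter f (toℕ i) x ≡ y
      bounded r with m , m<L , e ← reaches-bounded x∈B r =
        fromℕ< m<L , trans (cong (λ t → iter f t x) (toℕ-fromℕ< m<L)) e

    isCycleRep-sound : ∀ {x} → x ∈ B → T (isCycleRep f (length B) x) → OrbitMin f x
    isCycleRep-sound x∈B rep y r with m , m<L , refl ← reaches-bounded x∈B r =
      All.lookup (all⁺ _ (upTo (length B)) rep) (∈-upTo⁺ m<L)

  isCycleRep-resp : ∀ {f B B′ x} → Permutes f B → Permutes f B′ → x ∈ B → x ∈ B′ →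
                    isCycleRep f (length B) x ≡ isCycleRep f (length B′) x
  isCycleRep-resp {B = B} {B′} perm perm′ x∈B x∈B′ =
    T-injective (isCycleRep-complete (length B′) ∘ isCycleRep-sound perm x∈B)
                (isCycleRep-complete (length B) ∘ isCycleRep-sound perm′ x∈B′)

  bypass : (A → A) → A → A → A
  bypass f x y with f y ≟ x
  ... | yes _ = f x
  ... | no  _ = f y

  bypass-hit : ∀ {f x y} → f y ≡ x → bypass f x y ≡ f x
  bypass-hit {f} {x} {y} fy≡x with f y ≟ x
  ... | yes _    = refl
  ... | no fy≢x = ⊥-elim (fy≢x fy≡x)

  bypass-miss : ∀ {f x y} → f y ≢ x → bypass f x y ≡ f y
  bypass-miss {f} {x} {y} fy≢x with f y ≟ x
  ... | yes fy≡x = ⊥-elim (fy≢x fy≡x)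
  ... | no _     = refl

  module _ {f : A → A} {x : A} (fx≢x : f x ≢ x) where

    bypass-≢ : ∀ y → bypass f x y ≢ x
    bypass-≢ y with f y ≟ x
    ... | yes _    = fx≢x
    ... | no fy≢x = fy≢x

    reaches-bypass⇒ : ∀ {y z} → Reaches (bypass f x) y z → Reaches f y z
    reaches-bypass⇒ (zero  , refl) = reaches-refl
    reaches-bypass⇒ (suc m , refl) = reaches-trans (reaches-bypass⇒ (m , refl)) (step _)
      where
      step : ∀ w → Reaches f w (bypass f x w)
      step w with f w ≟ x
      ... | yes fw≡x = 2 , cong f fw≡x
      ... | no _     = reaches-step

    bypass-avoids : ∀ {y z} → y ≢ x → Reaches (bypass f x) y z → z ≢ x
    bypass-avoids y≢x (zero  , refl) = y≢x
    bypass-avoids y≢x (suc m , refl) = bypass-≢ _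

    reaches⇒bypass : ∀ {y z} → y ≢ x → Reaches f y z → z ≢ x → Reaches (bypass f x) y z
    reaches⇒bypass y≢x (m , fᵐy≡z) = go m y≢x fᵐy≡z
      where
      go : ∀ m {y z} → y ≢ x → iter f m y ≡ z → z ≢ x → Reaches (bypass f x) y z
      go zero _ refl _ = reaches-refl
      go (suc m) {y} y≢x fᵐ⁺¹y≡z z≢x with f y ≟ x
      ... | no fy≢x = reaches-trans (1 , bypass-miss fy≢x)
                        (go m fy≢x (trans (sym (iter-sucʳ f m y)) fᵐ⁺¹y≡z) z≢x)
      go (suc zero)    y≢x fy≡z z≢x | yes fy≡x = ⊥-elim (z≢x (trans (sym fy≡z) fy≡x))
      go (suc (suc m)) {y} y≢x fᵐ⁺²y≡z z≢x | yes fy≡x = reaches-trans (1 , bypass-hit fy≡x)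
        (go m fx≢x (trans (cong (iter f m ∘ f) (sym fy≡x))
                     (trans (sym (iter-sucʳ f m (f y))) (trans (sym (iter-sucʳ f (suc m) y)) fᵐ⁺²y≡z))) z≢x)

    bypass-permutes : ∀ {B} → Permutes f B → x ∈ B → Permutes (bypass f x) (B ─ x)
    bypass-permutes {B} perm x∈B = record { closed = closed′ ; injective = injective′ }
      where
      closed′ : ∀ {y} → y ∈ B ─ x → bypass f x y ∈ B ─ x
      closed′ {y} y∈ with f y ≟ x
      ... | yes _    = ∈-─⁺ (closed perm x∈B) fx≢x
      ... | no fy≢x = ∈-─⁺ (closed perm (proj₁ (∈-─⁻ B y∈))) fy≢x
      injective′ : ∀ {y z} → y ∈ B ─ x → z ∈ B ─ x → bypass f x y ≡ bypass f x z → y ≡ z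
      injective′ {y} {z} y∈ z∈ eq
        with y∈B , y≢x ← ∈-─⁻ B y∈ | z∈B , z≢x ← ∈-─⁻ B z∈ | f y ≟ x | f z ≟ x
      ... | yes fy≡x | yes fz≡x = injective perm y∈B z∈B (trans fy≡x (sym fz≡x))
      ... | yes _    | no _     = ⊥-elim (z≢x (sym (injective perm x∈B z∈B eq)))
      ... | no _     | yes _    = ⊥-elim (y≢x (injective perm y∈B x∈B eq))
      ... | no _     | no _     = injective perm y∈B z∈B eq

  module _ {f B x} (u : Unique B) (perm : Permutes f B) (x∈B : x ∈ B) (fx≢x : f x ≢ x) where
    private
      g : A → A
      g = bypass f x
      permᵍ : Permutes g (B ─ x)
      permᵍ = bypass-permutes fx≢x perm x∈B
      repᶠ repᵍ : A → Bool
      repᶠ = isCycleRep f (length B)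
      repᵍ = isCycleRep g (length (B ─ x))

    -- minimality for f and for g can only differ for y whose f-orbit passes through x, at x itself
    isCycleRep-bypass : ∀ {y} → y ∈ B ─ x → (OrbitMin g y → Reaches f y x → T (y ⊑ x)) → repᶠ y ≡ repᵍ y
    isCycleRep-bypass {y} y∈ y⊑x = T-injective
      (λ rep → isCycleRep-complete (length (B ─ x)) (λ z r → isCycleRep-sound perm y∈B rep z (reaches-bypass⇒ fx≢x r)))
      (λ rep → isCycleRep-complete (length B) (minᶠ (isCycleRep-sound permᵍ y∈ rep)))
      where
      y∈B : y ∈ B
      y∈B = proj₁ (∈-─⁻ B y∈)
      y≢x : y ≢ x
      y≢x = proj₂ (∈-─⁻ B y∈)
      minᶠ : OrbitMin g y → OrbitMin f y
      minᶠ minᵍ z r with z ≟ x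
      ... | yes refl = y⊑x minᵍ r
      ... | no z≢x   = minᵍ z (reaches⇒bypass fx≢x y≢x r z≢x)

    cycles-bypass-nonminimal : repᶠ x ≡ false → cycles f B ≡ cycles g (B ─ x)
    cycles-bypass-nonminimal repx =
      trans (count-─-false repᶠ u x∈B repx) (count-cong (B ─ x) (λ y∈ → isCycleRep-bypass y∈ (y⊑x y∈)))
      where
      -- if x ⊑ y for a g-minimal y on the cycle of x, then x would be f-minimal
      y⊑x : ∀ {y} → y ∈ B ─ x → OrbitMin g y → Reaches f y x → T (y ⊑ x)
      y⊑x {y} y∈ minᵍ y↝x with ⊑.total y x
      ... | inj₁ y⊑x = y⊑x
      ... | inj₂ x⊑y = ⊥-elim (subst T repx (isCycleRep-complete (length B) minx))
        where
        minx : OrbitMin f x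
        minx w x↝w with w ≟ x
        ... | yes refl = ⊑-refl x
        ... | no w≢x   = ⊑.trans x⊑y (minᵍ w (reaches⇒bypass fx≢x (proj₂ (∈-─⁻ B y∈)) (reaches-trans y↝x x↝w) w≢x))

    -- if x is the least element of its cycle, the least element y* of the rest of that cycle replaces it
    module _ (minx : OrbitMin f x) where
      private
        Orbit? : ∀ z → Dec (Reaches f x z × z ≢ x)
        Orbit? z = reaches? perm x∈B z ×-dec ¬? (z ≟ x)
        orbit : List A
        orbit = filter Orbit? B
        y* : A
        y* = min ⊑-totalOrder (f x) orbit

        y*-orbit : y* ∈ B × Reaches f x y* × y* ≢ x
        y*-orbit with argmin-sel ⊑-totalOrder id (f x) orbit
        ... | inj₁ y*≡fx rewrite y*≡fx = closed perm x∈B , reaches-step , fx≢x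
        ... | inj₂ y*∈   = ∈-filter⁻ Orbit? {xs = B} y*∈

        y*∈B : y* ∈ B
        y*∈B = proj₁ y*-orbit
        x↝y* : Reaches f x y*
        x↝y* = proj₁ (proj₂ y*-orbit)
        y*≢x : y* ≢ x
        y*≢x = proj₂ (proj₂ y*-orbit)

        y*-min : ∀ {z} → z ∈ B → Reaches f x z → z ≢ x → T (y* ⊑ z)
        y*-min z∈B x↝z z≢x = All.lookup (min≤xs ⊑-totalOrder (f x) orbit) (∈-filter⁺ Orbit? z∈B (x↝z , z≢x))

        y*-not-repᶠ : repᶠ y* ≡ false
        y*-not-repᶠ = T-injective not-rep λ ()
          where
          not-rep : ¬ T (repᶠ y*)
          not-rep rep = y*≢x (⊑.antisym (isCycleRep-sound perm y*∈B rep x (reaches-sym perm x∈B x↝y*)) (minx y* x↝y*))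

        y*-repᵍ : repᵍ y* ≡ true
        y*-repᵍ = Equivalence.to T-≡ (isCycleRep-complete (length (B ─ x)) λ z y*↝ᵍz →
          let m , fᵐy*≡z = reaches-bypass⇒ fx≢x y*↝ᵍz in
          y*-min (subst (_∈ B) fᵐy*≡z (iter-∈ perm m y*∈B)) (reaches-trans x↝y* (m , fᵐy*≡z))
                 (bypass-avoids fx≢x y*≢x y*↝ᵍz))

        repᶠ≡repᵍ : ∀ {y} → y ∈ B ─ x → y ≢ y* → repᶠ y ≡ repᵍ y
        repᶠ≡repᵍ {y} y∈ y≢y* with y∈B , y≢x ← ∈-─⁻ B y∈ | reaches? perm y∈B x
        ... | no ¬y↝x = isCycleRep-bypass y∈ (λ _ y↝x → ⊥-elim (¬y↝x y↝x))
        ... | yes y↝x = trans (T-injective notᶠ λ ()) (T-injective (λ ()) notᵍ)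
          where
          x↝y : Reaches f x y
          x↝y = reaches-sym perm y∈B y↝x
          notᶠ : ¬ T (repᶠ y)
          notᶠ rep = y≢x (⊑.antisym (isCycleRep-sound perm y∈B rep x y↝x) (minx y x↝y))
          notᵍ : ¬ T (repᵍ y)
          notᵍ rep = y≢y* (⊑.antisym
            (isCycleRep-sound permᵍ y∈ rep y* (reaches⇒bypass fx≢x y≢x (reaches-trans y↝x x↝y*) y*≢x))
            (y*-min y∈B x↝y y≢x))

      cycles-bypass-minimal : cycles f B ≡ cycles g (B ─ x)
      cycles-bypass-minimal =
        trans (count-─-true repᶠ u x∈B (Equivalence.to T-≡ (isCycleRep-complete (length B) minx)))
              (sym (count-flip (─-unique u) (∈-─⁺ y*∈B y*≢x) y*-not-repᶠ y*-repᵍ repᶠ≡repᵍ))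

    cycles-bypass : cycles f B ≡ cycles g (B ─ x)
    cycles-bypass with repᶠ x in repx
    ... | false = cycles-bypass-nonminimal repx
    ... | true  = cycles-bypass-minimal (isCycleRep-sound perm x∈B (subst T (sym repx) _))

  fixed⇒orbitMin : ∀ {f x} → f x ≡ x → OrbitMin f x
  fixed⇒orbitMin {f} {x} fx≡x y (m , refl) = subst (λ z → T (x ⊑ z)) (sym (fixed m)) (⊑-refl x)
    where
    fixed : ∀ m → iter f m x ≡ x
    fixed zero    = refl
    fixed (suc m) = trans (cong f (fixed m)) fx≡x

  module _ {f B x} (u : Unique B) (perm : Permutes f B) (x∈B : x ∈ B) (fx≡x : f x ≡ x) where

    permutes-─-fixed : Permutes f (B ─ x)
    permutes-─-fixed = record
      { closed    = λ {y} y∈ → let y∈B , y≢x = ∈-─⁻ B y∈ in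
                    ∈-─⁺ (closed perm y∈B) (λ fy≡x → y≢x (injective perm y∈B x∈B (trans fy≡x (sym fx≡x))))
      ; injective = λ y∈ z∈ → injective perm (proj₁ (∈-─⁻ B y∈)) (proj₁ (∈-─⁻ B z∈))
      }

    cycles-─-fixed : cycles f B ≡ suc (cycles f (B ─ x))
    cycles-─-fixed =
      trans (count-─-true _ u x∈B (Equivalence.to T-≡ (isCycleRep-complete (length B) (fixed⇒orbitMin fx≡x))))
            (cong suc (count-cong (B ─ x) (λ y∈ → isCycleRep-resp perm permutes-─-fixed (proj₁ (∈-─⁻ B y∈)) y∈)))

  module _ {f g : A → A} {B : List A} (perm : Permutes f B) (f≗g : ∀ {y} → y ∈ B → f y ≡ g y) where

    cycles-cong : cycles f B ≡ cycles g B
    cycles-cong = count-cong B λ {y} y∈ → cong and (map-cong (λ m → cong (y ⊑_) (iter-cong m y∈)) (upTo (length B)))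
      where
      iter-cong : ∀ m {y} → y ∈ B → iter f m y ≡ iter g m y
      iter-cong zero    _  = refl
      iter-cong (suc m) y∈ = trans (f≗g (iter-∈ perm m y∈)) (cong g (iter-cong m y∈))

  module _ {f : A → A} {B B′ : List A} (B↭B′ : B ↭ B′) where

    permutes-↭ : Permutes f B → Permutes f B′
    permutes-↭ perm = record
      { closed    = λ y∈ → ∈-resp-↭ B↭B′ (closed perm (∈-resp-↭ (↭-sym B↭B′) y∈))
      ; injective = λ y∈ z∈ → injective perm (∈-resp-↭ (↭-sym B↭B′) y∈) (∈-resp-↭ (↭-sym B↭B′) z∈)
      }

    cycles-↭ : cycles f B ≡ cycles f B′
    cycles-↭ = trans (cong (λ L → count (isCycleRep f L) B) (↭-length B↭B′)) (count-↭ _ B↭B′)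

  transpose : A → A → A → A
  transpose p q y with y ≟ p
  ... | yes _ = q
  ... | no  _ with y ≟ q
  ...   | yes _ = p
  ...   | no  _ = y

  module _ {p q : A} where

    transpose-p : transpose p q p ≡ q
    transpose-p with p ≟ p
    ... | yes _   = refl
    ... | no p≢p = ⊥-elim (p≢p refl)

    transpose-q : p ≢ q → transpose p q q ≡ p
    transpose-q p≢q with q ≟ p
    ... | yes q≡p = ⊥-elim (p≢q (sym q≡p))
    ... | no _ with q ≟ q
    ...   | yes _   = refl
    ...   | no q≢q = ⊥-elim (q≢q refl)

    transpose-other : ∀ {y} → y ≢ p → y ≢ q → transpose p q y ≡ y
    transpose-other {y} y≢p y≢q with y ≟ p
    ... | yes y≡p = ⊥-elim (y≢p y≡p)
    ... | no _ with y ≟ q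
    ...   | yes y≡q = ⊥-elim (y≢q y≡q)
    ...   | no _    = refl

    transpose-∈ : ∀ {B y} → p ∈ B → q ∈ B → y ∈ B → transpose p q y ∈ B
    transpose-∈ {y = y} p∈ q∈ y∈ with y ≟ p
    ... | yes _ = q∈
    ... | no _ with y ≟ q
    ...   | yes _ = p∈
    ...   | no _  = y∈

    transpose-involutive : p ≢ q → ∀ y → transpose p q (transpose p q y) ≡ y
    transpose-involutive p≢q y with y ≟ p
    ... | yes refl = transpose-q p≢q
    ... | no y≢p with y ≟ q
    ...   | yes refl = transpose-p
    ...   | no y≢q   = transpose-other y≢p y≢q

    permutes-∘-transpose : ∀ {f B} → Permutes f B → p ∈ B → q ∈ B → p ≢ q → Permutes (f ∘ transpose p q) B
    permutes-∘-transpose perm p∈ q∈ p≢q = record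
      { closed    = closed perm ∘ transpose-∈ p∈ q∈
      ; injective = λ {y} {z} y∈ z∈ eq → begin
          y                                    ≡⟨ transpose-involutive p≢q y ⟨
          transpose p q (transpose p q y)      ≡⟨ cong (transpose p q) (injective perm (transpose-∈ p∈ q∈ y∈) (transpose-∈ p∈ q∈ z∈) eq) ⟩
          transpose p q (transpose p q z)      ≡⟨ transpose-involutive p≢q z ⟩
          z                                    ∎
      }
      where open ≡-Reasoning

    bypass-∘-transpose : ∀ {f x} → x ≢ p → x ≢ q → ∀ y →
                         bypass (f ∘ transpose p q) x y ≡ bypass f x (transpose p q y)
    bypass-∘-transpose {f} {x} x≢p x≢q y with f (transpose p q y) ≟ x
    ... | yes _ = cong f (transpose-other x≢p x≢q)
    ... | no _  = refl

  isCycleRep-2 : ∀ {f x y} → f x ≡ y → isCycleRep f 2 x ≡ x ⊑ y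
  isCycleRep-2 {f} {x} refl rewrite Equivalence.to (T-≡ {x ⊑ x}) (⊑-refl x) = ∧-identityʳ (x ⊑ f x)

  module _ {f : A → A} {p q : A} (p≢q : p ≢ q) where

    cycles-pair-fixed : f p ≡ p → f q ≡ q → cycles f (p ∷ q ∷ []) ≡ 2
    cycles-pair-fixed fp≡p fq≡q =
      trans (count-∷-true (isCycleRep f 2) (rep fp≡p)) (cong suc (count-∷-true (isCycleRep f 2) (rep fq≡q)))
      where
      rep : ∀ {x} → f x ≡ x → isCycleRep f 2 x ≡ true
      rep fx≡x = Equivalence.to T-≡ (isCycleRep-complete 2 (fixed⇒orbitMin {f} fx≡x))

    cycles-pair-swapped : f p ≡ q → f q ≡ p → cycles f (p ∷ q ∷ []) ≡ 1
    cycles-pair-swapped fp≡q fq≡p with p ⊑ q in p⊑q | q ⊑ p in q⊑p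
    ... | true  | true  = ⊥-elim (p≢q (⊑.antisym (subst T (sym p⊑q) _) (subst T (sym q⊑p) _)))
    ... | true  | false = trans (count-∷-true (isCycleRep f 2) (trans (isCycleRep-2 {f} fp≡q) p⊑q))
                                (cong suc (count-∷-false (isCycleRep f 2) (trans (isCycleRep-2 {f} fq≡p) q⊑p)))
    ... | false | true  = trans (count-∷-false (isCycleRep f 2) (trans (isCycleRep-2 {f} fp≡q) p⊑q))
                                (count-∷-true (isCycleRep f 2) (trans (isCycleRep-2 {f} fq≡p) q⊑p))
    ... | false | false with ⊑.total p q
    ...   | inj₁ p⊑q′ = ⊥-elim (subst T p⊑q p⊑q′)
    ...   | inj₂ q⊑p′ = ⊥-elim (subst T q⊑p q⊑p′)

  module _ {f B p q} (u : Unique B) (perm : Permutes f B) (p∈ : p ∈ B) (q∈ : q ∈ B) (p≢q : p ≢ q) where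
    private
      permᵍ : Permutes (f ∘ transpose p q) B
      permᵍ = permutes-∘-transpose perm p∈ q∈ p≢q

    cycles-∘-transpose-pair : (∀ {z} → z ∈ B → z ≡ p ⊎ z ≡ q) → cycles (f ∘ transpose p q) B ~₁ cycles f B
    cycles-∘-transpose-pair only = subst₂ _~₁_ (sym (cycles-↭ B↭pq)) (sym (cycles-↭ B↭pq)) pair
      where
      B↭pq : B ↭ p ∷ q ∷ []
      B↭pq = unique-↭ u ((p≢q ∷ []) ∷ [] ∷ [])
        (λ z∈ → [ (λ { refl → here refl }) , (λ { refl → there (here refl) }) ] (only z∈))
        (λ { (here refl) → p∈ ; (there (here refl)) → q∈ })
      fτp : ∀ {y} → f q ≡ y → f (transpose p q p) ≡ y
      fτp = trans (cong f transpose-p)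
      fτq : ∀ {y} → f p ≡ y → f (transpose p q q) ≡ y
      fτq = trans (cong f (transpose-q p≢q))
      pair : cycles (f ∘ transpose p q) (p ∷ q ∷ []) ~₁ cycles f (p ∷ q ∷ [])
      pair with only (closed perm p∈) | only (closed perm q∈)
      ... | inj₁ fp≡p | inj₁ fq≡p = ⊥-elim (p≢q (injective perm p∈ q∈ (trans fp≡p (sym fq≡p))))
      ... | inj₂ fp≡q | inj₂ fq≡q = ⊥-elim (p≢q (injective perm p∈ q∈ (trans fp≡q (sym fq≡q))))
      ... | inj₁ fp≡p | inj₂ fq≡q = inj₂ (trans (cong suc (cycles-pair-swapped p≢q (fτp fq≡q) (fτq fp≡p)))
                                                (sym (cycles-pair-fixed p≢q fp≡p fq≡q)))
      ... | inj₂ fp≡q | inj₁ fq≡p = inj₁ (trans (cycles-pair-fixed p≢q (fτp fq≡p) (fτq fp≡q))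
                                                (cong suc (sym (cycles-pair-swapped p≢q fp≡q fq≡p))))

    -- dropping a fixed point and bypassing x both commute with the transposition of p and q
    cycles-∘-transpose-─ : ∀ {x} → x ∈ B → x ≢ p → x ≢ q →
      (∀ {h} → Permutes h (B ─ x) → cycles (h ∘ transpose p q) (B ─ x) ~₁ cycles h (B ─ x)) →
      cycles (f ∘ transpose p q) B ~₁ cycles f B
    cycles-∘-transpose-─ {x} x∈ x≢p x≢q ih with f x ≟ x
    ... | yes fx≡x = subst₂ _~₁_
      (sym (cycles-─-fixed u permᵍ x∈ (trans (cong f (transpose-other x≢p x≢q)) fx≡x)))
      (sym (cycles-─-fixed u perm x∈ fx≡x))
      (~₁-suc (ih (permutes-─-fixed u perm x∈ fx≡x)))
    ... | no fx≢x = subst₂ _~₁_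
      (sym (trans (cycles-bypass u permᵍ x∈ gx≢x)
                  (cycles-cong (bypass-permutes gx≢x permᵍ x∈) λ {y} _ → bypass-∘-transpose x≢p x≢q y)))
      (sym (cycles-bypass u perm x∈ fx≢x))
      (ih (bypass-permutes fx≢x perm x∈))
      where
      gx≢x : f (transpose p q x) ≢ x
      gx≢x = fx≢x ∘ trans (sym (cong f (transpose-other x≢p x≢q)))

  cycles-∘-transpose : ∀ {f B p q} → Unique B → Permutes f B → p ∈ B → q ∈ B → p ≢ q →
                       cycles (f ∘ transpose p q) B ~₁ cycles f B
  cycles-∘-transpose {B = B} = go (length B) refl
    where
    go : ∀ n {f B p q} → length B ≡ n → Unique B → Permutes f B → p ∈ B → q ∈ B → p ≢ q →
         cycles (f ∘ transpose p q) B ~₁ cycles f B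
    go n {B = B} {p} {q} len u perm p∈ q∈ p≢q with Any.any? (λ x → ¬? (x ≟ p) ×-dec ¬? (x ≟ q)) B | n
    ... | no none | _ = cycles-∘-transpose-pair u perm p∈ q∈ p≢q only
      where
      only : ∀ {z} → z ∈ B → z ≡ p ⊎ z ≡ q
      only {z} z∈ with z ≟ p | z ≟ q
      ... | yes z≡p | _       = inj₁ z≡p
      ... | no _    | yes z≡q = inj₂ z≡q
      ... | no z≢p  | no z≢q  = ⊥-elim (none (lose z∈ (z≢p , z≢q)))
    ... | yes some | zero with () ← trans (sym (length-─ u (proj₁ (proj₂ (find some))))) len
    ... | yes some | suc n with x , x∈ , x≢p , x≢q ← find some =
      cycles-∘-transpose-─ u perm p∈ q∈ p≢q x∈ x≢p x≢q λ permʰ →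
        go n (suc-injective (trans (sym (length-─ u x∈)) len)) (─-unique u) permʰ
             (∈-─⁺ p∈ (≢-sym x≢p)) (∈-─⁺ q∈ (≢-sym x≢q)) p≢q

  -- σ′ arises from σ by removing a₁, a₂ and adding b₁, b₂: the paths p₁ ↦ a₁ ↦ σ a₁ and
  -- p₂ ↦ a₂ ↦ σ a₂ of σ become p₁ ↦ σ a₂ and p₂ ↦ b₁ ↦ b₂ ↦ σ a₁, everything else is unchanged.
  record Splice (σ σ′ : A → A) (B B′ : List A) : Set where
    field
      a₁ a₂ b₁ b₂ p₁ p₂ : A
      a₁∈B   : a₁ ∈ B
      a₂∈B   : a₂ ∈ B
      b₁∈B′  : b₁ ∈ B′
      b₂∈B′  : b₂ ∈ B′
      a₁∉B′  : a₁ ∉ B′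
      a₂∉B′  : a₂ ∉ B′
      b₁∉B   : b₁ ∉ B
      b₂∉B   : b₂ ∉ B
      B⊆B′   : ∀ {z} → z ∈ B → z ≢ a₁ → z ≢ a₂ → z ∈ B′
      B′⊆B   : ∀ {z} → z ∈ B′ → z ≢ b₁ → z ≢ b₂ → z ∈ B
      p₁∈B   : p₁ ∈ B
      p₂∈B   : p₂ ∈ B
      σp₁    : σ p₁ ≡ a₁
      σp₂    : σ p₂ ≡ a₂
      σa₂≢a₁ : σ a₂ ≢ a₁
      σa₂≢a₂ : σ a₂ ≢ a₂
      σ′p₁   : σ′ p₁ ≡ σ a₂
      σ′p₂   : σ′ p₂ ≡ b₁
      σ′b₁   : σ′ b₁ ≡ b₂
      σ′b₂   : σ′ b₂ ≡ σ a₁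
      σ′≡σ   : ∀ {y} → y ∈ B → y ∈ B′ → σ y ≢ a₁ → σ y ≢ a₂ → σ′ y ≡ σ y

  ∈∉⇒≢ : ∀ {z w} {C : List A} → z ∈ C → w ∉ C → z ≢ w
  ∈∉⇒≢ z∈C w∉C refl = w∉C z∈C

  bypass-miss₂ : ∀ {f a b y} → f y ≢ a → f y ≢ b → bypass (bypass f a) b y ≡ f y
  bypass-miss₂ fy≢a fy≢b = trans (bypass-miss (λ e → fy≢b (trans (sym (bypass-miss fy≢a)) e))) (bypass-miss fy≢a)

  module _ {σ σ′ B B′} (u : Unique B) (u′ : Unique B′) (perm : Permutes σ B) (perm′ : Permutes σ′ B′)
           (s : Splice σ σ′ B B′) where
    open Splice s
    open ≡-Reasoning

    private
      X Y : A
      X = σ a₁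
      Y = σ a₂
      X∈B : X ∈ B
      X∈B = closed perm a₁∈B
      Y∈B : Y ∈ B
      Y∈B = closed perm a₂∈B
      X∈B′ : X ∈ B′
      X∈B′ = subst (_∈ B′) σ′b₂ (closed perm′ b₂∈B′)
      a₁≢a₂ : a₁ ≢ a₂
      a₁≢a₂ refl = ∈∉⇒≢ Y∈B b₁∉B
        (trans (sym σ′p₁) (trans (cong σ′ (injective perm p₁∈B p₂∈B (trans σp₁ (sym σp₂)))) σ′p₂))
      b₁≢b₂ : b₁ ≢ b₂
      b₁≢b₂ refl = ∈∉⇒≢ X∈B b₂∉B (trans (sym σ′b₂) σ′b₁)

      f₁ f₀ g₁ g₀ : A → A
      f₁ = bypass σ a₁
      f₀ = bypass f₁ a₂
      g₁ = bypass σ′ b₁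
      g₀ = bypass g₁ b₂
      B₀ B₀′ : List A
      B₀ = B ─ a₁ ─ a₂
      B₀′ = B′ ─ b₁ ─ b₂
      a₂∈B₋ : a₂ ∈ B ─ a₁
      a₂∈B₋ = ∈-─⁺ a₂∈B (≢-sym a₁≢a₂)
      b₂∈B′₋ : b₂ ∈ B′ ─ b₁
      b₂∈B′₋ = ∈-─⁺ b₂∈B′ (≢-sym b₁≢b₂)
      f₁a₂≡Y : f₁ a₂ ≡ Y
      f₁a₂≡Y = bypass-miss σa₂≢a₁
      g₁b₂≡X : g₁ b₂ ≡ X
      g₁b₂≡X = trans (bypass-miss (λ e → ∈∉⇒≢ X∈B b₁∉B (trans (sym σ′b₂) e))) σ′b₂
      σa₁≢a₁ : σ a₁ ≢ a₁
      σa₁≢a₁ = ∈∉⇒≢ X∈B′ a₁∉B′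
      σ′b₁≢b₁ : σ′ b₁ ≢ b₁
      σ′b₁≢b₁ e = b₁≢b₂ (trans (sym e) σ′b₁)
      f₁a₂≢a₂ : f₁ a₂ ≢ a₂
      f₁a₂≢a₂ e = σa₂≢a₂ (trans (sym f₁a₂≡Y) e)
      g₁b₂≢b₂ : g₁ b₂ ≢ b₂
      g₁b₂≢b₂ e = ∈∉⇒≢ X∈B b₂∉B (trans (sym g₁b₂≡X) e)
      perm₁ : Permutes f₁ (B ─ a₁)
      perm₁ = bypass-permutes σa₁≢a₁ perm a₁∈B
      perm₀ : Permutes f₀ B₀
      perm₀ = bypass-permutes f₁a₂≢a₂ perm₁ a₂∈B₋
      perm₁′ : Permutes g₁ (B′ ─ b₁)
      perm₁′ = bypass-permutes σ′b₁≢b₁ perm′ b₁∈B′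
      perm₀′ : Permutes g₀ B₀′
      perm₀′ = bypass-permutes g₁b₂≢b₂ perm₁′ b₂∈B′₋
      u₀ : Unique B₀
      u₀ = ─-unique (─-unique u)
      u₀′ : Unique B₀′
      u₀′ = ─-unique (─-unique u′)

      ∈B₀⁻ : ∀ {z} → z ∈ B₀ → z ∈ B × z ≢ a₁ × z ≢ a₂
      ∈B₀⁻ z∈ = let z∈₋ , z≢a₂ = ∈-─⁻ (B ─ a₁) z∈ ; z∈B , z≢a₁ = ∈-─⁻ B z∈₋ in z∈B , z≢a₁ , z≢a₂
      ∈B₀′⁻ : ∀ {z} → z ∈ B₀′ → z ∈ B′ × z ≢ b₁ × z ≢ b₂
      ∈B₀′⁻ z∈ = let z∈₋ , z≢b₂ = ∈-─⁻ (B′ ─ b₁) z∈ ; z∈B′ , z≢b₁ = ∈-─⁻ B′ z∈₋ in z∈B′ , z≢b₁ , z≢b₂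
      B₀⊆B₀′ : ∀ {z} → z ∈ B₀ → z ∈ B₀′
      B₀⊆B₀′ z∈ = let z∈B , z≢a₁ , z≢a₂ = ∈B₀⁻ z∈ in
        ∈-─⁺ (∈-─⁺ (B⊆B′ z∈B z≢a₁ z≢a₂) (∈∉⇒≢ z∈B b₁∉B)) (∈∉⇒≢ z∈B b₂∉B)
      B₀′⊆B₀ : ∀ {z} → z ∈ B₀′ → z ∈ B₀
      B₀′⊆B₀ z∈ = let z∈B′ , z≢b₁ , z≢b₂ = ∈B₀′⁻ z∈ in
        ∈-─⁺ (∈-─⁺ (B′⊆B z∈B′ z≢b₁ z≢b₂) (∈∉⇒≢ z∈B′ a₁∉B′)) (∈∉⇒≢ z∈B′ a₂∉B′)
      B₀′↭B₀ : B₀′ ↭ B₀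
      B₀′↭B₀ = unique-↭ u₀′ u₀ B₀′⊆B₀ B₀⊆B₀′

      p₁≢a₁ : p₁ ≢ a₁
      p₁≢a₁ refl = σa₁≢a₁ σp₁
      p₁≢a₂ : p₁ ≢ a₂
      p₁≢a₂ refl = σa₂≢a₁ σp₁
      p₂≢a₁ : p₂ ≢ a₁
      p₂≢a₁ refl = ∈∉⇒≢ X∈B′ a₂∉B′ σp₂
      p₂≢a₂ : p₂ ≢ a₂
      p₂≢a₂ refl = σa₂≢a₂ σp₂
      p₁≢p₂ : p₁ ≢ p₂
      p₁≢p₂ refl = a₁≢a₂ (trans (sym σp₁) σp₂)
      p₁∈B₀ : p₁ ∈ B₀
      p₁∈B₀ = ∈-─⁺ (∈-─⁺ p₁∈B p₁≢a₁) p₁≢a₂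
      p₂∈B₀ : p₂ ∈ B₀
      p₂∈B₀ = ∈-─⁺ (∈-─⁺ p₂∈B p₂≢a₁) p₂≢a₂

      σy≢a₁ : ∀ {y} → y ∈ B → y ≢ p₁ → σ y ≢ a₁
      σy≢a₁ y∈B y≢p₁ e = y≢p₁ (injective perm y∈B p₁∈B (trans e (sym σp₁)))
      σy≢a₂ : ∀ {y} → y ∈ B → y ≢ p₂ → σ y ≢ a₂
      σy≢a₂ y∈B y≢p₂ e = y≢p₂ (injective perm y∈B p₂∈B (trans e (sym σp₂)))

      -- matching on y ≟ p₁ and y ≟ p₂ also evaluates transpose p₁ p₂ y in the goal
      g₀≗f₀∘τ : ∀ {y} → y ∈ B₀ → g₀ y ≡ (f₀ ∘ transpose p₁ p₂) y
      g₀≗f₀∘τ {y} y∈ with y ≟ p₁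
      ... | yes refl = begin
          g₀ p₁                     ≡⟨ bypass-miss₂ (λ e → ∈∉⇒≢ Y∈B b₁∉B (trans (sym σ′p₁) e))
                                                    (λ e → ∈∉⇒≢ Y∈B b₂∉B (trans (sym σ′p₁) e)) ⟩
          σ′ p₁                     ≡⟨ σ′p₁ ⟩
          Y                         ≡⟨ f₁a₂≡Y ⟨
          f₁ a₂                     ≡⟨ bypass-hit (trans (bypass-miss (λ e → a₁≢a₂ (trans (sym e) σp₂))) σp₂) ⟨
          f₀ p₂                     ∎
      ... | no y≢p₁ with y ≟ p₂
      ...   | yes refl = begin
          g₀ p₂                     ≡⟨ bypass-hit (trans (bypass-hit σ′p₂) σ′b₁) ⟩
          g₁ b₂                     ≡⟨ g₁b₂≡X ⟩
          X                         ≡⟨ bypass-hit σp₁ ⟨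
          f₁ p₁                     ≡⟨ bypass-miss (λ e → ∈∉⇒≢ X∈B′ a₂∉B′ (trans (sym (bypass-hit σp₁)) e)) ⟨
          f₀ p₁                     ∎
      ...   | no y≢p₂ = begin
          g₀ y                      ≡⟨ bypass-miss₂ (λ e → ∈∉⇒≢ σy∈B b₁∉B (trans (sym σ′y≡σy) e))
                                                    (λ e → ∈∉⇒≢ σy∈B b₂∉B (trans (sym σ′y≡σy) e)) ⟩
          σ′ y                      ≡⟨ σ′y≡σy ⟩
          σ y                       ≡⟨ bypass-miss₂ (σy≢a₁ y∈B y≢p₁) (σy≢a₂ y∈B y≢p₂) ⟨
          f₀ y                      ∎
        where
        y∈B : y ∈ B
        y∈B = proj₁ (∈B₀⁻ y∈)
        σy∈B : σ y ∈ B
        σy∈B = closed perm y∈B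
        σ′y≡σy : σ′ y ≡ σ y
        σ′y≡σy = σ′≡σ y∈B (proj₁ (∈B₀′⁻ (B₀⊆B₀′ y∈))) (σy≢a₁ y∈B y≢p₁) (σy≢a₂ y∈B y≢p₂)

    -- after bypassing a₁, a₂ in σ and b₁, b₂ in σ′ the two maps differ by the transposition of p₁ and p₂
    cycles-splice : cycles σ′ B′ ~₁ cycles σ B
    cycles-splice = subst₂ _~₁_ (sym σ′-side) (sym σ-side)
      (cycles-∘-transpose u₀ perm₀ p₁∈B₀ p₂∈B₀ p₁≢p₂)
      where
      σ-side : cycles σ B ≡ cycles f₀ B₀
      σ-side = trans (cycles-bypass u perm a₁∈B σa₁≢a₁) (cycles-bypass (─-unique u) perm₁ a₂∈B₋ f₁a₂≢a₂)
      σ′-side : cycles σ′ B′ ≡ cycles (f₀ ∘ transpose p₁ p₂) B₀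
      σ′-side = begin
        cycles σ′ B′                     ≡⟨ cycles-bypass u′ perm′ b₁∈B′ σ′b₁≢b₁ ⟩
        cycles g₁ (B′ ─ b₁)              ≡⟨ cycles-bypass (─-unique u′) perm₁′ b₂∈B′₋ g₁b₂≢b₂ ⟩
        cycles g₀ B₀′                    ≡⟨ cycles-↭ B₀′↭B₀ ⟩
        cycles g₀ B₀                     ≡⟨ cycles-cong (permutes-↭ B₀′↭B₀ perm₀′) g₀≗f₀∘τ ⟩
        cycles (f₀ ∘ transpose p₁ p₂) B₀ ∎

-- Light beams in a region of cells

even : ℕ → Bool
even zero    = true
even (suc k) = not (even k)

xor-cancelˡ : ∀ a {b c} → a xor b ≡ a xor c → b ≡ c
xor-cancelˡ false eq = eq
xor-cancelˡ true  eq = not-injective eq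

xor-cancelʳ : ∀ {a b} c → a xor c ≡ b xor c → a ≡ b
xor-cancelʳ {a} {b} c eq = xor-cancelˡ c (trans (xor-comm c a) (trans eq (xor-comm b c)))

data Edge : Set where
  hor ver : ℕ → ℕ → Edge

_≟ᴱ_ : DecidableEquality Edge
hor i j ≟ᴱ hor k l = map′ (λ (i≡k , j≡l) → cong₂ hor i≡k j≡l) (λ { refl → refl , refl }) (i ≟ k ×-dec j ≟ l)
hor _ _ ≟ᴱ ver _ _ = no λ ()
ver _ _ ≟ᴱ hor _ _ = no λ ()
ver i j ≟ᴱ ver k l = map′ (λ (i≡k , j≡l) → cong₂ ver i≡k j≡l) (λ { refl → refl , refl }) (i ≟ k ×-dec j ≟ l)

lexᵇ : ℕ → ℕ → ℕ → ℕ → Bool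
lexᵇ i j k l = (i <ᵇ k) ∨ ((i ≡ᵇ k) ∧ (j ≤ᵇ l))

T-lexᵇ : ∀ {i j k l} → T (lexᵇ i j k l) ⇔ (i < k ⊎ (i ≡ k × j ≤ l))
T-lexᵇ {i} {j} {k} {l} = mk⇔ to from
  where
  to : T (lexᵇ i j k l) → i < k ⊎ (i ≡ k × j ≤ l)
  to t with Equivalence.to T-∨ t
  ... | inj₁ i<k = inj₁ (<ᵇ⇒< i k i<k)
  ... | inj₂ t′  = let i≡k , j≤l = Equivalence.to T-∧ t′ in inj₂ (≡ᵇ⇒≡ i k i≡k , ≤ᵇ⇒≤ j l j≤l)
  from : i < k ⊎ (i ≡ k × j ≤ l) → T (lexᵇ i j k l)
  from (inj₁ i<k)         = Equivalence.from T-∨ (inj₁ (<⇒<ᵇ i<k))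
  from (inj₂ (i≡k , j≤l)) = Equivalence.from T-∨ (inj₂ (Equivalence.from T-∧ (≡⇒≡ᵇ i k i≡k , ≤⇒≤ᵇ j≤l)))

module _ {i j k l : ℕ} where
  open Equivalence

  lexᵇ-antisym : T (lexᵇ i j k l) → T (lexᵇ k l i j) → i ≡ k × j ≡ l
  lexᵇ-antisym t t′ with to (T-lexᵇ {i} {j} {k} {l}) t | to (T-lexᵇ {k} {l} {i} {j}) t′
  ... | inj₁ i<k         | inj₁ k<i         = ⊥-elim (<-asym i<k k<i)
  ... | inj₁ i<k         | inj₂ (refl , _)  = ⊥-elim (<-irrefl refl i<k)
  ... | inj₂ (refl , _)  | inj₁ k<i         = ⊥-elim (<-irrefl refl k<i)
  ... | inj₂ (refl , j≤l) | inj₂ (_ , l≤j) = refl , ≤-antisym j≤l l≤j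

  lexᵇ-trans : ∀ {p q} → T (lexᵇ i j k l) → T (lexᵇ k l p q) → T (lexᵇ i j p q)
  lexᵇ-trans {p} {q} t t′ with to (T-lexᵇ {i} {j} {k} {l}) t | to (T-lexᵇ {k} {l} {p} {q}) t′
  ... | inj₁ i<k          | inj₁ k<p          = from (T-lexᵇ {i} {j} {p} {q}) (inj₁ (<-trans i<k k<p))
  ... | inj₁ i<k          | inj₂ (refl , _)   = from (T-lexᵇ {i} {j} {p} {q}) (inj₁ i<k)
  ... | inj₂ (refl , _)   | inj₁ k<p          = from (T-lexᵇ {i} {j} {p} {q}) (inj₁ k<p)
  ... | inj₂ (refl , j≤l) | inj₂ (refl , l≤q) = from (T-lexᵇ {i} {j} {p} {q}) (inj₂ (refl , ≤-trans j≤l l≤q))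

  lexᵇ-total : T (lexᵇ i j k l) ⊎ T (lexᵇ k l i j)
  lexᵇ-total with <-cmp i k | ≤-total j l
  ... | tri< i<k _ _ | _        = inj₁ (from (T-lexᵇ {i} {j} {k} {l}) (inj₁ i<k))
  ... | tri> _ _ k<i | _        = inj₂ (from (T-lexᵇ {k} {l} {i} {j}) (inj₁ k<i))
  ... | tri≈ _ refl _ | inj₁ j≤l = inj₁ (from (T-lexᵇ {i} {j} {k} {l}) (inj₂ (refl , j≤l)))
  ... | tri≈ _ refl _ | inj₂ l≤j = inj₂ (from (T-lexᵇ {k} {l} {i} {j}) (inj₂ (refl , l≤j)))

_⊑_ : Edge → Edge → Bool
hor i j ⊑ hor k l = lexᵇ i j k l
hor _ _ ⊑ ver _ _ = true
ver _ _ ⊑ hor _ _ = false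
ver i j ⊑ ver k l = lexᵇ i j k l

⊑-isTotalOrder : IsTotalOrder _≡_ (λ x y → T (x ⊑ y))
⊑-isTotalOrder = record
  { isPartialOrder = record
    { isPreorder = record { isEquivalence = isEquivalence ; reflexive = reflexive ; trans = λ {x} {y} {z} → trans′ {x} {y} {z} }
    ; antisym    = antisym }
  ; total          = total }
  where
  reflexive : ∀ {x y} → x ≡ y → T (x ⊑ y)
  reflexive {hor i j} refl = Equivalence.from (T-lexᵇ {i} {j}) (inj₂ (refl , ≤-refl))
  reflexive {ver i j} refl = Equivalence.from (T-lexᵇ {i} {j}) (inj₂ (refl , ≤-refl))
  trans′ : ∀ {x y z} → T (x ⊑ y) → T (y ⊑ z) → T (x ⊑ z)
  trans′ {hor i j} {hor k l} {hor _ _} = lexᵇ-trans {i} {j} {k} {l}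
  trans′ {ver i j} {ver k l} {ver _ _} = lexᵇ-trans {i} {j} {k} {l}
  trans′ {hor _ _} {_}       {ver _ _} = λ _ _ → _
  trans′ {hor _ _} {ver _ _} {hor _ _} = λ _ ()
  trans′ {ver _ _} {hor _ _} {_}       = λ ()
  trans′ {ver _ _} {ver _ _} {hor _ _} = λ _ ()
  antisym : ∀ {x y} → T (x ⊑ y) → T (y ⊑ x) → x ≡ y
  antisym {hor i j} {hor k l} t t′ with refl , refl ← lexᵇ-antisym {i} {j} {k} {l} t t′ = refl
  antisym {ver i j} {ver k l} t t′ with refl , refl ← lexᵇ-antisym {i} {j} {k} {l} t t′ = refl
  antisym {hor _ _} {ver _ _} _ ()
  antisym {ver _ _} {hor _ _} ()
  total : ∀ x y → T (x ⊑ y) ⊎ T (y ⊑ x)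
  total (hor i j) (hor k l) = lexᵇ-total {i} {j} {k} {l}
  total (ver i j) (ver k l) = lexᵇ-total {i} {j} {k} {l}
  total (hor _ _) (ver _ _) = inj₁ _
  total (ver _ _) (hor _ _) = inj₂ _

open Cycles _≟ᴱ_ _⊑_ ⊑-isTotalOrder

record Beam : Set where
  constructor beam
  field
    col row  : ℕ
    dx dy hz : Bool
open Beam

data Outcome : Set where
  hit  : Edge → Outcome
  move : Beam → Outcome

-- A beam that entered its cell through a horizontal side (hz) leaves it through a vertical one,
-- and vice versa; there is no next cell beyond the axes.
ahead : Beam → Maybe Beam
ahead (beam i j dx dy true)  = aheadˣ dx i j
  where
  aheadˣ : Bool → ℕ → ℕ → Maybe Beam
  aheadˣ true  i       j = just (beam (suc i) j true dy false)
  aheadˣ false zero    j = nothing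
  aheadˣ false (suc i) j = just (beam i j false dy false)
ahead (beam i j dx dy false) = aheadʸ dy i j
  where
  aheadʸ : Bool → ℕ → ℕ → Maybe Beam
  aheadʸ true  i j       = just (beam i (suc j) dx true true)
  aheadʸ false i zero    = nothing
  aheadʸ false i (suc j) = just (beam i j dx false true)

exit : Beam → Edge
exit (beam i j dx dy true)  = if dx then ver (suc i) j else ver i j
exit (beam i j dx dy false) = if dy then hor i (suc j) else hor i j

behind : Beam → Beam
behind (beam i j dx dy false) = if dx then beam (i ∸ 1) j true dy true else beam (suc i) j false dy true
behind (beam i j dx dy true)  = if dy then beam i (j ∸ 1) dx true false else beam i (suc j) dx false false

isVer : Edge → Bool
isVer (hor _ _) = false
isVer (ver _ _) = true

isVer-exit : ∀ x → isVer (exit x) ≡ hz x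
isVer-exit (beam i j true  dy    true)  = refl
isVer-exit (beam i j false dy    true)  = refl
isVer-exit (beam i j dx    true  false) = refl
isVer-exit (beam i j dx    false false) = refl

source : Beam → Edge
source (beam i j dx dy true)  = if dy then hor i j else hor i (suc j)
source (beam i j dx dy false) = if dx then ver i j else ver (suc i) j

-- Invariant along a beam: every crossing flips both the colour of the cell and hz.
parity : Beam → Bool
parity (beam i j dx dy hz) = dx xor (dy xor (even (i + j) xor hz))

ahead-behind : ∀ {x y} → ahead x ≡ just y → x ≡ behind y
ahead-behind {beam i       j       true  dy    true}  refl = refl
ahead-behind {beam (suc i) j       false dy    true}  refl = refl
ahead-behind {beam i       j       dx    true  false} refl = refl
ahead-behind {beam i       (suc j) dx    false false} refl = refl

ahead-parity : ∀ {x y} → ahead x ≡ just y → parity y ≡ parity x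
ahead-parity {beam i       j       true  dy    true}  refl =
  cong (λ t → true xor (dy xor t)) (xor-annihilates-not (even (i + j)) true)
ahead-parity {beam (suc i) j       false dy    true}  refl =
  cong (λ t → false xor (dy xor t)) (sym (xor-annihilates-not (even (i + j)) false))
ahead-parity {beam i       j       dx    true  false} refl rewrite +-suc i j =
  cong (λ t → dx xor (true xor t)) (xor-annihilates-not (even (i + j)) false)
ahead-parity {beam i       (suc j) dx    false false} refl rewrite +-suc i j =
  cong (λ t → dx xor (false xor t)) (sym (xor-annihilates-not (even (i + j)) true))

ahead-direction : ∀ {x y} → ahead x ≡ just y → dx y ≡ dx x × dy y ≡ dy x
ahead-direction {beam i       j       true  dy    true}  refl = refl , refl
ahead-direction {beam (suc i) j       false dy    true}  refl = refl , refl
ahead-direction {beam i       j       dx    true  false} refl = refl , refl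
ahead-direction {beam i       (suc j) dx    false false} refl = refl , refl

RightOf : ℕ → Edge → Set
RightOf a (hor i j) = a ≤ i
RightOf a (ver i j) = a < i

BelowOf : ℕ → Edge → Set
BelowOf a (hor i j) = j ≤ a
BelowOf a (ver i j) = j ≤ a

InGrid : ℕ → Edge → Set
InGrid n (hor i j) = i < n × j ≤ n
InGrid n (ver i j) = i ≤ n × j < n

-- The light beams of Polygon in Defs, for an arbitrary region of cells inside [0,n)².
module Billiard (n : ℕ) (inside : ℕ → ℕ → Bool)
                (inside⇒< : ∀ {i j} → inside i j ≡ true → i < n × j < n) where

  insideᴮ : Beam → Bool
  insideᴮ b = inside (col b) (row b)

  advanceTo : Beam → Maybe Beam → Outcome
  advanceTo b nothing  = hit (exit b)
  advanceTo b (just y) = if insideᴮ y then move y else hit (exit b)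

  advance : Beam → Outcome
  advance b = advanceTo b (ahead b)

  travel : ℕ → Edge → Beam → Edge
  travel zero       d b = d
  travel (suc fuel) d b with advance b
  ... | hit e   = e
  ... | move b′ = travel fuel d b′

  insideBelow : ℕ → ℕ → Bool
  insideBelow i zero    = false
  insideBelow i (suc j) = inside i j

  insideLeft : ℕ → ℕ → Bool
  insideLeft zero    j = false
  insideLeft (suc i) j = inside i j

  isBoundary : Edge → Bool
  isBoundary (hor i j) = inside i j xor insideBelow i j
  isBoundary (ver i j) = inside i j xor insideLeft i j

  emit : Edge → Beam
  emit (hor i j) = if inside i j then beam i j (even (i + j)) true true
                                 else beam i (j ∸ 1) (even (i + j)) false true
  emit (ver i j) = if inside i j then beam i j true (not (even (i + j))) false
                                 else beam (i ∸ 1) j false (not (even (i + j))) false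

  fuel : ℕ
  fuel = 4 * suc n * suc n

  σ : Edge → Edge
  σ e = travel fuel e (emit e)

  Moves : Beam → Beam → Set
  Moves x y = advance x ≡ move y

  Blocked : Beam → Set
  Blocked x = ∀ y → ahead x ≡ just y → insideᴮ y ≡ false

  advance-move : ∀ {x y} → Moves x y → ahead x ≡ just y × insideᴮ y ≡ true
  advance-move {x} with ahead x
  ... | nothing = λ ()
  ... | just z with insideᴮ z in z-in
  ...   | true  = λ { refl → refl , z-in }
  ...   | false = λ ()

  advance-hit : ∀ {x e} → advance x ≡ hit e → e ≡ exit x × Blocked x
  advance-hit {x} with ahead x
  ... | nothing = λ { refl → refl , λ _ () }
  ... | just z with insideᴮ z in z-in
  ...   | true  = λ ()
  ...   | false = λ { refl → refl , λ { _ refl → z-in } }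

  advance-into : ∀ {x y} → ahead x ≡ just y → insideᴮ y ≡ true → Moves x y
  advance-into ahead≡ y-in rewrite ahead≡ | y-in = refl

  advance-blocked : ∀ {x} → Blocked x → advance x ≡ hit (exit x)
  advance-blocked {x} blocked with ahead x
  ... | nothing = refl
  ... | just y rewrite blocked y refl = refl

  moves-injective : ∀ {x x′ y} → Moves x y → Moves x′ y → x ≡ x′
  moves-injective {x} {x′} m m′ =
    trans (ahead-behind (proj₁ (advance-move {x} m))) (sym (ahead-behind (proj₁ (advance-move {x′} m′))))

  Steps : Beam → Beam → Set
  Steps = Star Moves

  Hits : Beam → Edge → Set
  Hits b e = ∃ λ f → Steps b f × advance f ≡ hit e

  steps-inside : ∀ {a c} → insideᴮ a ≡ true → Steps a c → insideᴮ c ≡ true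
  steps-inside a-in ε                 = a-in
  steps-inside _    (_◅_ {i = x} m s) = steps-inside (proj₂ (advance-move {x} m)) s

  steps-parity : ∀ {a c} → Steps a c → parity c ≡ parity a
  steps-parity ε                 = refl
  steps-parity (_◅_ {i = x} m s) = trans (steps-parity s) (ahead-parity {x} (proj₁ (advance-move {x} m)))

  steps-hits : ∀ {a a′ e} → Steps a a′ → Hits a′ e → Hits a e
  steps-hits s (f , s′ , h) = f , s ◅◅ s′ , h

  hits-unique : ∀ {b e e′} → Hits b e → Hits b e′ → e ≡ e′
  hits-unique (_ , s , h) (_ , s′ , h′) = go s h s′ h′
    where
    go : ∀ {b f f′ e e′} → Steps b f → advance f ≡ hit e → Steps b f′ → advance f′ ≡ hit e′ → e ≡ e′
    go ε       h ε         h′ with refl ← trans (sym h) h′ = refl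
    go ε       h (m′ ◅ _)  _  with () ← trans (sym h) m′
    go (m ◅ _) _ ε         h′ with () ← trans (sym h′) m
    go (m ◅ s) h (m′ ◅ s′) h′ with refl ← trans (sym m) m′ = go s h s′ h′

  -- moves are injective, so two paths to the same beam can be retraced backwards together
  backtrack : ∀ {a a′ c} → Star (λ y x → Moves x y) c a → Star (λ y x → Moves x y) c a′ →
              insideᴮ a ≡ true → insideᴮ a′ ≡ true →
              (∀ {x} → insideᴮ x ≡ true → ¬ Moves x a) → (∀ {x} → insideᴮ x ≡ true → ¬ Moves x a′) → a ≡ a′
  backtrack ε        ε          _    _     _      _       = refl
  backtrack ε (_◅_ {j = x} m′ s′) _ a′-in a-orig _ =
    ⊥-elim (a-orig {x} (steps-inside a′-in (reverse id s′)) m′)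
  backtrack (_◅_ {j = x} m s) ε a-in _ _ a′-orig =
    ⊥-elim (a′-orig {x} (steps-inside a-in (reverse id s)) m)
  backtrack (_◅_ {j = x} m s) (_◅_ {j = x′} m′ s′) a-in a′-in a-orig a′-orig
    with refl ← moves-injective {x} {x′} m m′ =
    backtrack s s′ a-in a′-in (λ {y} → a-orig {y}) (λ {y} → a′-orig {y})

  -- every move brings the beam closer to the walls it is heading for
  distance : Beam → ℕ
  distance (beam i j dx dy hz) = (if dx then n ∸ suc i else i) + (if dy then n ∸ suc j else j)

  ahead-distance : ∀ {x y} → ahead x ≡ just y → insideᴮ y ≡ true → distance y < distance x
  ahead-distance {beam i j true dy true} refl y-in =
    +-monoˡ-< (if dy then n ∸ suc j else j) (∸-monoʳ-< (n<1+n (suc i)) (proj₁ (inside⇒< y-in)))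
  ahead-distance {beam (suc i) j false dy true} refl _ =
    +-monoˡ-< (if dy then n ∸ suc j else j) (n<1+n i)
  ahead-distance {beam i j dx true false} refl y-in =
    +-monoʳ-< (if dx then n ∸ suc i else i) (∸-monoʳ-< (n<1+n (suc j)) (proj₂ (inside⇒< y-in)))
  ahead-distance {beam i (suc j) dx false false} refl _ =
    +-monoʳ-< (if dx then n ∸ suc i else i) (n<1+n j)

  travel-hits : ∀ k {x} d → insideᴮ x ≡ true → distance x < k → Hits x (travel k d x)
  travel-hits (suc k) {x} d x-in (s≤s dist<k) with advance x in adv
  ... | hit e  = x , ε , adv
  ... | move y with ahead≡ , y-in ← advance-move {x} adv
               with f , s , h ← travel-hits k d y-in (<-≤-trans (ahead-distance {x} ahead≡ y-in) dist<k) =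
    f , adv ◅ s , h

  distance<fuel : ∀ {x} → insideᴮ x ≡ true → distance x < fuel
  distance<fuel {beam i j dx dy hz} x-in =
    <-≤-trans (+-mono-< (bound dx (proj₁ (inside⇒< x-in))) (bound dy (proj₂ (inside⇒< x-in))))
              (≤-trans (+-mono-≤ (n≤1+n n) (≤-trans (n≤1+n n) (m≤m+n (suc n) _))) (m≤m*n (4 * suc n) (suc n)))
    where
    bound : ∀ d {m} → m < n → (if d then n ∸ suc m else m) < n
    bound true  m<n = ∸-monoʳ-< (s≤s z≤n) m<n
    bound false m<n = m<n

  insideBelow⇒ : ∀ {i j} → insideBelow i j ≡ true → ∃ λ j′ → j ≡ suc j′ × inside i j′ ≡ true
  insideBelow⇒ {j = suc j′} below = j′ , refl , below

  insideLeft⇒ : ∀ {i j} → insideLeft i j ≡ true → ∃ λ i′ → i ≡ suc i′ × inside i′ j ≡ true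
  insideLeft⇒ {i = suc i′} left = i′ , refl , left

  source-emit : ∀ {e} → isBoundary e ≡ true → source (emit e) ≡ e
  source-emit {hor i j} b with inside i j
  ... | true = refl
  ... | false with _ , refl , _ ← insideBelow⇒ {i} {j} b = refl
  source-emit {ver i j} b with inside i j
  ... | true = refl
  ... | false with _ , refl , _ ← insideLeft⇒ {i} {j} b = refl

  emit-injective : ∀ {e e′} → isBoundary e ≡ true → isBoundary e′ ≡ true → emit e ≡ emit e′ → e ≡ e′
  emit-injective b b′ eq = trans (sym (source-emit b)) (trans (cong source eq) (source-emit b′))

  emit-inside : ∀ {e} → isBoundary e ≡ true → insideᴮ (emit e) ≡ true
  emit-inside {hor i j} b with inside i j in i-in
  ... | true  = i-in
  ... | false with _ , refl , below ← insideBelow⇒ {i} {j} b = below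
  emit-inside {ver i j} b with inside i j in i-in
  ... | true  = i-in
  ... | false with _ , refl , left ← insideLeft⇒ {i} {j} b = left

  emit-parity : ∀ {e} → isBoundary e ≡ true → parity (emit e) ≡ false
  emit-parity {hor i j} b with inside i j
  ... | true with even (i + j)
  ...   | true  = refl
  ...   | false = refl
  emit-parity {hor i j} b | false with j′ , refl , _ ← insideBelow⇒ {i} {j} b rewrite +-suc i j′ with even (i + j′)
  ...   | true  = refl
  ...   | false = refl
  emit-parity {ver i j} b with inside i j
  ... | true with even (i + j)
  ...   | true  = refl
  ...   | false = refl
  emit-parity {ver i j} b | false with i′ , refl , _ ← insideLeft⇒ {i} {j} b with even (i′ + j)
  ...   | true  = refl
  ...   | false = refl

  -- the cell behind an emitted beam is outside, so no beam inside moves into it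
  emit-origin : ∀ {e x} → isBoundary e ≡ true → insideᴮ x ≡ true → ¬ Moves x (emit e)
  emit-origin {hor i zero} {x} b x-in m
    with ahead≡ , _ ← advance-move {x} m
    with refl ← ahead-behind {x} ahead≡
    with inside i zero
  ... | true  with () ← ahead≡
  ... | false with () ← b
  emit-origin {hor i (suc j)} {x} b x-in m
    with ahead≡ , _ ← advance-move {x} m
    with refl ← ahead-behind {x} ahead≡
    with inside i (suc j) in i-in
  ... | true  with () ← trans (sym b) (cong not x-in)
  ... | false with () ← trans (sym x-in) i-in
  emit-origin {ver zero j} {x} b x-in m
    with ahead≡ , _ ← advance-move {x} m
    with refl ← ahead-behind {x} ahead≡
    with inside zero j
  ... | true  with () ← ahead≡
  ... | false with () ← b
  emit-origin {ver (suc i) j} {x} b x-in m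
    with ahead≡ , _ ← advance-move {x} m
    with refl ← ahead-behind {x} ahead≡
    with inside (suc i) j in i-in
  ... | true  with () ← trans (sym b) (cong not x-in)
  ... | false with () ← trans (sym x-in) i-in

  exit-boundary : ∀ {x} → insideᴮ x ≡ true → Blocked x → isBoundary (exit x) ≡ true
  exit-boundary {beam i       j       true  dy    true}  x-in blocked rewrite x-in | blocked _ refl = refl
  exit-boundary {beam zero    j       false dy    true}  x-in blocked rewrite x-in = refl
  exit-boundary {beam (suc i) j       false dy    true}  x-in blocked rewrite x-in | blocked _ refl = refl
  exit-boundary {beam i       j       dx    true  false} x-in blocked rewrite x-in | blocked _ refl = refl
  exit-boundary {beam i       zero    dx    false false} x-in blocked rewrite x-in = refl
  exit-boundary {beam i       (suc j) dx    false false} x-in blocked rewrite x-in | blocked _ refl = refl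

  exit-inGrid : ∀ {x} → insideᴮ x ≡ true → InGrid n (exit x)
  exit-inGrid {beam i j true  dy    true}  x-in = inside⇒< x-in
  exit-inGrid {beam i j false dy    true}  x-in = <⇒≤ (proj₁ (inside⇒< x-in)) , proj₂ (inside⇒< x-in)
  exit-inGrid {beam i j dx    true  false} x-in = inside⇒< x-in
  exit-inGrid {beam i j dx    false false} x-in = proj₁ (inside⇒< x-in) , <⇒≤ (proj₂ (inside⇒< x-in))

  hits-boundary : ∀ {b e} → insideᴮ b ≡ true → Hits b e → isBoundary e ≡ true × InGrid n e
  hits-boundary b-in (f , s , h) with refl , blocked ← advance-hit {f} h =
    exit-boundary {f} (steps-inside b-in s) blocked , exit-inGrid {f} (steps-inside b-in s)

  exit-injective : ∀ {x x′} → insideᴮ x ≡ true → insideᴮ x′ ≡ true → parity x ≡ parity x′ →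
                   Blocked x → Blocked x′ → exit x ≡ exit x′ → x ≡ x′
  exit-injective {beam i j true dy true} {beam _ _ true dy′ true} _ _ par _ _ refl =
    cong (λ t → beam i j true t true) (xor-cancelʳ _ (xor-cancelˡ true par))
  exit-injective {beam i j false dy true} {beam _ _ false dy′ true} _ _ par _ _ refl =
    cong (λ t → beam i j false t true) (xor-cancelʳ _ (xor-cancelˡ false par))
  exit-injective {beam i j true _ true} {beam _ _ false _ true} _ x′-in _ blocked _ refl
    with () ← trans (sym (blocked _ refl)) x′-in
  exit-injective {beam i j false _ true} {beam _ _ true _ true} x-in _ _ _ blocked′ refl
    with () ← trans (sym (blocked′ _ refl)) x-in
  exit-injective {beam i j dx true false} {beam _ _ dx′ true false} _ _ par _ _ refl =
    cong (λ t → beam i j t true false) (xor-cancelʳ _ par)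
  exit-injective {beam i j dx false false} {beam _ _ dx′ false false} _ _ par _ _ refl =
    cong (λ t → beam i j t false false) (xor-cancelʳ _ par)
  exit-injective {beam i j _ true false} {beam _ _ _ false false} _ x′-in _ blocked _ refl
    with () ← trans (sym (blocked _ refl)) x′-in
  exit-injective {beam i j _ false false} {beam _ _ _ true false} x-in _ _ _ blocked′ refl
    with () ← trans (sym (blocked′ _ refl)) x-in
  exit-injective {x@(beam _ _ _ _ true)} {x′@(beam _ _ _ _ false)} _ _ _ _ _ eq
    with () ← trans (sym (isVer-exit x)) (trans (cong isVer eq) (isVer-exit x′))
  exit-injective {x@(beam _ _ _ _ false)} {x′@(beam _ _ _ _ true)} _ _ _ _ _ eq
    with () ← trans (sym (isVer-exit x)) (trans (cong isVer eq) (isVer-exit x′))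

  σ-hits : ∀ {z} → isBoundary z ≡ true → Hits (emit z) (σ z)
  σ-hits {z} b = travel-hits fuel z (emit-inside {z} b) (distance<fuel {emit z} (emit-inside {z} b))

  σ-unique : ∀ {z e} → isBoundary z ≡ true → Hits (emit z) e → σ z ≡ e
  σ-unique {z} b = hits-unique (σ-hits {z} b)

  σ-boundary : ∀ {z} → isBoundary z ≡ true → isBoundary (σ z) ≡ true × InGrid n (σ z)
  σ-boundary {z} b = hits-boundary (emit-inside {z} b) (σ-hits {z} b)

  -- two beams hitting the same side end in the same blocked beam, and retracing it leads back to one emission
  σ-injective : ∀ {z z′} → isBoundary z ≡ true → isBoundary z′ ≡ true → σ z ≡ σ z′ → z ≡ z′
  σ-injective {z} {z′} b b′ eq
    with f , s , h ← σ-hits {z} b | f′ , s′ , h′ ← σ-hits {z′} b′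
    with σz≡ , blocked ← advance-hit {f} h | σz′≡ , blocked′ ← advance-hit {f′} h′
    with refl ← exit-injective {f} {f′} (steps-inside (emit-inside {z} b) s) (steps-inside (emit-inside {z′} b′) s′)
                  (trans (steps-parity s) (trans (emit-parity {z} b) (sym (trans (steps-parity s′) (emit-parity {z′} b′)))))
                  blocked blocked′ (trans (sym σz≡) (trans eq σz′≡)) =
    emit-injective b b′ (backtrack (reverse id s) (reverse id s′) (emit-inside {z} b) (emit-inside {z′} b′)
                                   (λ {x} → emit-origin {z} {x} b) (λ {x} → emit-origin {z′} {x} b′))

  steps-rightward : ∀ {a c} → Steps a c → dx a ≡ true → col a ≤ col c × dx c ≡ true
  steps-rightward ε dx≡ = ≤-refl , dx≡
  steps-rightward (_◅_ {i = x} m s) dx≡ with ahead≡ , _ ← advance-move {x} m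
    with a≤ , dx≡′ ← steps-rightward s (trans (proj₁ (ahead-direction {x} ahead≡)) dx≡) =
    ≤-trans (step {x} ahead≡ dx≡) a≤ , dx≡′
    where
    step : ∀ {x y} → ahead x ≡ just y → dx x ≡ true → col x ≤ col y
    step {beam i j       true dy    true}  refl _ = n≤1+n i
    step {beam i j       dx   true  false} refl _ = ≤-refl
    step {beam i (suc j) dx   false false} refl _ = ≤-refl

  steps-downward : ∀ {a c} → Steps a c → dy a ≡ false → row c ≤ row a × dy c ≡ false
  steps-downward ε dy≡ = ≤-refl , dy≡
  steps-downward (_◅_ {i = x} m s) dy≡ with ahead≡ , _ ← advance-move {x} m
    with c≤ , dy≡′ ← steps-downward s (trans (proj₂ (ahead-direction {x} ahead≡)) dy≡) =
    ≤-trans c≤ (step {x} ahead≡ dy≡) , dy≡′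
    where
    step : ∀ {x y} → ahead x ≡ just y → dy x ≡ false → row y ≤ row x
    step {beam i       j       true  false true}  refl _ = ≤-refl
    step {beam (suc i) j       false false true}  refl _ = ≤-refl
    step {beam i       (suc j) dx    false false} refl _ = n≤1+n j

  hits-rightward : ∀ {b e} → Hits b e → dx b ≡ true → RightOf (col b) e
  hits-rightward (f , s , h) dx≡ with refl , _ ← advance-hit {f} h | a≤ , dx≡′ ← steps-rightward s dx≡ =
    exit-right f a≤ dx≡′
    where
    exit-right : ∀ x {a} → a ≤ col x → dx x ≡ true → RightOf a (exit x)
    exit-right (beam i j true dy    true)  a≤ _ = s≤s a≤
    exit-right (beam i j true true  false) a≤ _ = a≤
    exit-right (beam i j true false false) a≤ _ = a≤

  hits-downward : ∀ {b e} → Hits b e → dy b ≡ false → BelowOf (row b) e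
  hits-downward (f , s , h) dy≡ with refl , _ ← advance-hit {f} h | c≤ , dy≡′ ← steps-downward s dy≡ =
    exit-below f c≤ dy≡′
    where
    exit-below : ∀ x {a} → row x ≤ a → dy x ≡ false → BelowOf a (exit x)
    exit-below (beam i j true  false true)  c≤ _ = c≤
    exit-below (beam i j false false true)  c≤ _ = c≤
    exit-below (beam i j dx    false false) c≤ _ = c≤

  record BoundaryList (B : List Edge) : Set where
    field
      unique   : Unique B
      sound    : ∀ {z} → z ∈ B → isBoundary z ≡ true × InGrid n z
      complete : ∀ {z} → isBoundary z ≡ true → InGrid n z → z ∈ B

  σ-permutes : ∀ {B} → BoundaryList B → Permutes σ B
  σ-permutes bl = record
    { closed    = λ {z} z∈ → let b , _ = sound z∈ ; b′ , g′ = σ-boundary {z} b in complete b′ g′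
    ; injective = λ {z} {z′} z∈ z′∈ → σ-injective {z} {z′} (proj₁ (sound z∈)) (proj₁ (sound z′∈))
    }
    where open BoundaryList bl

-- Adding one cell to the region

record CellAdded (inside inside′ : ℕ → ℕ → Bool) (k b : ℕ) : Set where
  field
    unchanged : ∀ {i j} → (i , j) ≢ (k , suc b) → inside′ i j ≡ inside i j
    cell-out  : inside k (suc b) ≡ false
    cell-in′  : inside′ k (suc b) ≡ true
    below-in  : inside k b ≡ true
    right-in  : inside (suc k) (suc b) ≡ true
    above-out : inside k (suc (suc b)) ≡ false
    left-out  : ∀ {k′} → k ≡ suc k′ → inside k′ (suc b) ≡ false

module AddCell {n : ℕ} {inside inside′ : ℕ → ℕ → Bool}
  (inside⇒<  : ∀ {i j} → inside i j ≡ true → i < n × j < n)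
  (inside′⇒< : ∀ {i j} → inside′ i j ≡ true → i < n × j < n)
  {k b : ℕ} (added : CellAdded inside inside′ k b) where

  open CellAdded added
  module O = Billiard n inside inside⇒<
  module N = Billiard n inside′ inside′⇒<

  private
    c : ℕ
    c = suc b

  h₀ v₁ h₁ v₀ : Edge
  h₀ = hor k c
  v₁ = ver (suc k) c
  h₁ = hor k (suc c)
  v₀ = ver k c

  below-in′ : inside′ k b ≡ true
  below-in′ = trans (unchanged λ ()) below-in

  right-in′ : inside′ (suc k) c ≡ true
  right-in′ = trans (unchanged λ ()) right-in

  above-out′ : inside′ k (suc c) ≡ false
  above-out′ = trans (unchanged λ ()) above-out

  left-out′ : ∀ {k′} → k ≡ suc k′ → inside′ k′ c ≡ false
  left-out′ refl = trans (unchanged λ ()) (left-out refl)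

  unchanged-inside : ∀ {i j} → inside i j ≡ true → inside′ i j ≡ inside i j
  unchanged-inside {i} {j} i-in = unchanged not-cell
    where
    not-cell : (i , j) ≢ (k , c)
    not-cell refl with () ← trans (sym i-in) cell-out

  moves-transfer : ∀ {x y} → O.Moves x y → N.Moves x y
  moves-transfer {x} m with ahead≡ , y-in ← O.advance-move {x} m =
    N.advance-into {x} ahead≡ (trans (unchanged-inside y-in) y-in)

  steps-transfer : ∀ {a f} → O.Steps a f → N.Steps a f
  steps-transfer = Star.map (λ {x} → moves-transfer {x})

  entering-cell : ∀ {x y} → O.insideᴮ x ≡ true → ahead x ≡ just y → (col y , row y) ≡ (k , c) →
                  exit x ≡ h₀ ⊎ exit x ≡ v₁
  entering-cell {beam i       j       true  dy    true}  x-in refl refl with () ← trans (sym x-in) (left-out refl)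
  entering-cell {beam (suc i) j       false dy    true}  x-in refl refl = inj₂ refl
  entering-cell {beam i       j       dx    true  false} x-in refl refl = inj₁ refl
  entering-cell {beam i       (suc j) dx    false false} x-in refl refl with () ← trans (sym x-in) above-out

  hit-transfer : ∀ {x e} → O.insideᴮ x ≡ true → O.advance x ≡ hit e → e ≢ h₀ → e ≢ v₁ → N.advance x ≡ hit e
  hit-transfer {x} x-in h e≢h₀ e≢v₁ with refl , blocked ← O.advance-hit {x} h = N.advance-blocked {x} blocked′
    where
    blocked′ : N.Blocked x
    blocked′ y ahead≡ with ≡-dec _≟_ _≟_ (col y , row y) (k , c)
    ... | yes at-cell = [ ⊥-elim ∘ e≢h₀ , ⊥-elim ∘ e≢v₁ ]′ (entering-cell {x} x-in ahead≡ at-cell)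
    ... | no elsewhere = trans (unchanged elsewhere) (blocked y ahead≡)

  hits-transfer : ∀ {a e} → O.insideᴮ a ≡ true → O.Hits a e → e ≢ h₀ → e ≢ v₁ → N.Hits a e
  hits-transfer a-in (f , s , h) e≢h₀ e≢v₁ =
    f , steps-transfer s , hit-transfer {f} (O.steps-inside a-in s) h e≢h₀ e≢v₁

  emit-unchanged : ∀ {z} → z ≢ h₀ → z ≢ v₀ → N.emit z ≡ O.emit z
  emit-unchanged {hor i j} z≢h₀ _ rewrite unchanged {i} {j} (λ { refl → z≢h₀ refl }) = refl
  emit-unchanged {ver i j} _ z≢v₀ rewrite unchanged {i} {j} (λ { refl → z≢v₀ refl }) = refl

  boundary-unchanged : ∀ {z} → z ≢ h₀ → z ≢ v₁ → z ≢ h₁ → z ≢ v₀ → N.isBoundary z ≡ O.isBoundary z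
  boundary-unchanged {hor i zero} _ _ _ _
    rewrite unchanged {i} {zero} (λ ()) = refl
  boundary-unchanged {hor i (suc j)} z≢h₀ _ z≢h₁ _
    rewrite unchanged {i} {suc j} (λ { refl → z≢h₀ refl }) | unchanged {i} {j} (λ { refl → z≢h₁ refl }) = refl
  boundary-unchanged {ver zero j} _ _ _ z≢v₀
    rewrite unchanged {zero} {j} (λ { refl → z≢v₀ refl }) = refl
  boundary-unchanged {ver (suc i) j} _ z≢v₁ _ z≢v₀
    rewrite unchanged {suc i} {j} (λ { refl → z≢v₀ refl }) | unchanged {i} {j} (λ { refl → z≢v₁ refl }) = refl

  left-outside : O.insideLeft k c ≡ false
  left-outside = go k refl
    where
    go : ∀ m → m ≡ k → O.insideLeft m c ≡ false
    go zero    _   = refl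
    go (suc m) m≡k = left-out (sym m≡k)

  left-outside′ : N.insideLeft k c ≡ false
  left-outside′ = go k refl
    where
    go : ∀ m → m ≡ k → N.insideLeft m c ≡ false
    go zero    _   = refl
    go (suc m) m≡k = left-out′ (sym m≡k)

  h₀-boundary  : O.isBoundary h₀ ≡ true
  h₀-boundary rewrite cell-out | below-in = refl
  h₀-interior′ : N.isBoundary h₀ ≡ false
  h₀-interior′ rewrite cell-in′ | below-in′ = refl
  v₁-boundary  : O.isBoundary v₁ ≡ true
  v₁-boundary rewrite right-in | cell-out = refl
  v₁-interior′ : N.isBoundary v₁ ≡ false
  v₁-interior′ rewrite right-in′ | cell-in′ = refl
  h₁-exterior  : O.isBoundary h₁ ≡ false
  h₁-exterior rewrite above-out | cell-out = refl
  h₁-boundary′ : N.isBoundary h₁ ≡ true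
  h₁-boundary′ rewrite above-out′ | cell-in′ = refl
  v₀-exterior  : O.isBoundary v₀ ≡ false
  v₀-exterior rewrite cell-out | left-outside = refl
  v₀-boundary′ : N.isBoundary v₀ ≡ true
  v₀-boundary′ rewrite cell-in′ | left-outside′ = refl

  -- d is the parity of the new cell, which fixes the directions of the beams through it
  module _ {d : Bool} (cell-parity : even (k + c) ≡ d) where

    emit-v₁ : O.emit v₁ ≡ beam (suc k) c true d false
    emit-v₁ rewrite right-in | not-involutive (even (k + c)) | cell-parity = refl

    emit-h₀ : O.emit h₀ ≡ beam k b d false true
    emit-h₀ rewrite cell-out | cell-parity = refl

    emit-h₁′ : N.emit h₁ ≡ beam k c (not d) false true
    emit-h₁′ rewrite above-out′ | +-suc k c | cell-parity = refl

    emit-v₀′ : N.emit v₀ ≡ beam k c true (not d) false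
    emit-v₀′ rewrite cell-in′ | cell-parity = refl

    even-below : even (k + b) ≡ not d
    even-below = trans (sym (not-involutive (even (k + b)))) (cong not (trans (cong even (sym (+-suc k b))) cell-parity))

    parity-below : parity (beam k b d true false) ≡ false
    parity-below rewrite even-below = lemma d
      where
      lemma : ∀ d → d xor (true xor (not d xor false)) ≡ false
      lemma true  = refl
      lemma false = refl

    parity-right : parity (beam (suc k) c false d true) ≡ false
    parity-right rewrite cell-parity = lemma d
      where
      lemma : ∀ d → false xor (d xor (not d xor true)) ≡ false
      lemma true  = refl
      lemma false = refl

    arrival-h₀ : ∀ {a} → O.insideᴮ a ≡ true → parity a ≡ false → O.Hits a h₀ → O.Steps a (beam k b d true false)
    arrival-h₀ a-in a-parity (f , s , h) with h₀≡ , blocked ← O.advance-hit {f} h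
      with refl ← O.exit-injective {f} {beam k b d true false} (O.steps-inside a-in s) below-in
                    (trans (O.steps-parity s) (trans a-parity (sym parity-below))) blocked (λ { _ refl → cell-out }) (sym h₀≡)
      = s

    arrival-v₁ : ∀ {a} → O.insideᴮ a ≡ true → parity a ≡ false → O.Hits a v₁ → O.Steps a (beam (suc k) c false d true)
    arrival-v₁ a-in a-parity (f , s , h) with v₁≡ , blocked ← O.advance-hit {f} h
      with refl ← O.exit-injective {f} {beam (suc k) c false d true} (O.steps-inside a-in s) right-in
                    (trans (O.steps-parity s) (trans a-parity (sym parity-right))) blocked (λ { _ refl → cell-out }) (sym v₁≡)
      = s

  cell-to-right : ∀ dy′ → N.Moves (beam k c true dy′ true) (beam (suc k) c true dy′ false)
  cell-to-right dy′ = N.advance-into {beam k c true dy′ true} refl right-in′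

  cell-to-left : ∀ dy′ → N.advance (beam k c false dy′ true) ≡ hit v₀
  cell-to-left dy′ = go k refl
    where
    go : ∀ m → m ≡ k → N.advance (beam m c false dy′ true) ≡ hit (ver m c)
    go zero    _   = refl
    go (suc m) m≡k = N.advance-blocked {beam (suc m) c false dy′ true} λ { _ refl → left-out′ (sym m≡k) }

  cell-to-top : ∀ dx′ → N.advance (beam k c dx′ true false) ≡ hit h₁
  cell-to-top dx′ = N.advance-blocked {beam k c dx′ true false} λ { _ refl → above-out′ }

  cell-to-bottom : ∀ dx′ → N.Moves (beam k c dx′ false false) (beam k b dx′ false true)
  cell-to-bottom dx′ = N.advance-into {beam k c dx′ false false} refl below-in′

  into-cell-from-below : ∀ d → N.Moves (beam k b d true false) (beam k c d true true)
  into-cell-from-below d = N.advance-into {beam k b d true false} refl cell-in′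

  into-cell-from-right : ∀ d → N.Moves (beam (suc k) c false d true) (beam k c false d false)
  into-cell-from-right d = N.advance-into {beam (suc k) c false d true} refl cell-in′

  σv₁-right : RightOf (suc k) (O.σ v₁)
  σv₁-right = subst (λ a → RightOf a (O.σ v₁)) (proj₂ emit-v₁-rightward)
                    (O.hits-rightward (O.σ-hits {v₁} v₁-boundary) (proj₁ emit-v₁-rightward))
    where
    emit-v₁-rightward : dx (O.emit v₁) ≡ true × col (O.emit v₁) ≡ suc k
    emit-v₁-rightward rewrite right-in = refl , refl

  σh₀-below : BelowOf b (O.σ h₀)
  σh₀-below = subst (λ a → BelowOf a (O.σ h₀)) (proj₂ emit-h₀-downward)
                    (O.hits-downward (O.σ-hits {h₀} h₀-boundary) (proj₁ emit-h₀-downward))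
    where
    emit-h₀-downward : dy (O.emit h₀) ≡ false × row (O.emit h₀) ≡ b
    emit-h₀-downward rewrite cell-out = refl , refl

  σv₁≢h₀ : O.σ v₁ ≢ h₀
  σv₁≢h₀ eq = <-irrefl refl (subst (RightOf (suc k)) eq σv₁-right)

  σv₁≢v₁ : O.σ v₁ ≢ v₁
  σv₁≢v₁ eq = <-irrefl refl (subst (RightOf (suc k)) eq σv₁-right)

  σh₀≢h₀ : O.σ h₀ ≢ h₀
  σh₀≢h₀ eq = <-irrefl refl (subst (BelowOf b) eq σh₀-below)

  σh₀≢v₁ : O.σ h₀ ≢ v₁
  σh₀≢v₁ eq = <-irrefl refl (subst (BelowOf b) eq σh₀-below)

  module _ {B B′} (bl : O.BoundaryList B) (bl′ : N.BoundaryList B′) where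
    private
      module bl  = O.BoundaryList bl
      module bl′ = N.BoundaryList bl′

      perm : Permutes O.σ B
      perm = O.σ-permutes bl
      perm′ : Permutes N.σ B′
      perm′ = N.σ-permutes bl′

      sk<n : suc k < n
      sk<n = proj₁ (inside⇒< right-in)
      c<n : c < n
      c<n = proj₂ (inside⇒< right-in)
      k<n : k < n
      k<n = <-trans (n<1+n k) sk<n

      h₀∈B : h₀ ∈ B
      h₀∈B = bl.complete {h₀} h₀-boundary (k<n , <⇒≤ c<n)
      v₁∈B : v₁ ∈ B
      v₁∈B = bl.complete {v₁} v₁-boundary (<⇒≤ sk<n , c<n)
      h₁∈B′ : h₁ ∈ B′
      h₁∈B′ = bl′.complete {h₁} h₁-boundary′ (k<n , c<n)
      v₀∈B′ : v₀ ∈ B′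
      v₀∈B′ = bl′.complete {v₀} v₀-boundary′ (<⇒≤ k<n , c<n)

      h₀∉B′ : h₀ ∉ B′
      h₀∉B′ h₀∈ with () ← trans (sym (proj₁ (bl′.sound h₀∈))) h₀-interior′
      v₁∉B′ : v₁ ∉ B′
      v₁∉B′ v₁∈ with () ← trans (sym (proj₁ (bl′.sound v₁∈))) v₁-interior′
      h₁∉B : h₁ ∉ B
      h₁∉B h₁∈ with () ← trans (sym (proj₁ (bl.sound h₁∈))) h₁-exterior
      v₀∉B : v₀ ∉ B
      v₀∉B v₀∈ with () ← trans (sym (proj₁ (bl.sound v₀∈))) v₀-exterior

      B⊆B′ : ∀ {z} → z ∈ B → z ≢ h₀ → z ≢ v₁ → z ∈ B′
      B⊆B′ z∈ z≢h₀ z≢v₁ = bl′.complete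
        (trans (boundary-unchanged z≢h₀ z≢v₁ (∈∉⇒≢ z∈ h₁∉B) (∈∉⇒≢ z∈ v₀∉B)) (proj₁ (bl.sound z∈)))
        (proj₂ (bl.sound z∈))
      B′⊆B : ∀ {z} → z ∈ B′ → z ≢ h₁ → z ≢ v₀ → z ∈ B
      B′⊆B z∈ z≢h₁ z≢v₀ = bl.complete
        (trans (sym (boundary-unchanged (∈∉⇒≢ z∈ h₀∉B′) (∈∉⇒≢ z∈ v₁∉B′) z≢h₁ z≢v₀)) (proj₁ (bl′.sound z∈)))
        (proj₂ (bl′.sound z∈))

      p q : Edge
      p = proj₁ (preimage perm h₀∈B)
      q = proj₁ (preimage perm v₁∈B)
      p∈B : p ∈ B
      p∈B = proj₁ (proj₂ (preimage perm h₀∈B))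
      q∈B : q ∈ B
      q∈B = proj₁ (proj₂ (preimage perm v₁∈B))
      σp≡h₀ : O.σ p ≡ h₀
      σp≡h₀ = proj₂ (proj₂ (preimage perm h₀∈B))
      σq≡v₁ : O.σ q ≡ v₁
      σq≡v₁ = proj₂ (proj₂ (preimage perm v₁∈B))

      p≢h₀ : p ≢ h₀
      p≢h₀ eq = σh₀≢h₀ (trans (cong O.σ (sym eq)) σp≡h₀)
      p≢v₁ : p ≢ v₁
      p≢v₁ eq = σv₁≢h₀ (trans (cong O.σ (sym eq)) σp≡h₀)
      q≢h₀ : q ≢ h₀
      q≢h₀ eq = σh₀≢v₁ (trans (cong O.σ (sym eq)) σq≡v₁)
      q≢v₁ : q ≢ v₁
      q≢v₁ eq = σv₁≢v₁ (trans (cong O.σ (sym eq)) σq≡v₁)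
      p∈B′ : p ∈ B′
      p∈B′ = B⊆B′ p∈B p≢h₀ p≢v₁
      q∈B′ : q ∈ B′
      q∈B′ = B⊆B′ q∈B q≢h₀ q≢v₁

      σ′-from : ∀ {z e} → z ∈ B′ → z ≢ h₀ → z ≢ v₀ → N.Hits (O.emit z) e → N.σ z ≡ e
      σ′-from {z} {e} z∈ z≢h₀ z≢v₀ hits =
        N.σ-unique {z} (proj₁ (bl′.sound z∈)) (subst (λ t → N.Hits t e) (sym (emit-unchanged z≢h₀ z≢v₀)) hits)

      old-hits : ∀ {z} → z ∈ B → O.Hits (O.emit z) (O.σ z)
      old-hits {z} z∈ = O.σ-hits {z} (proj₁ (bl.sound z∈))

      σ′≡σ : ∀ {y} → y ∈ B → y ∈ B′ → O.σ y ≢ h₀ → O.σ y ≢ v₁ → N.σ y ≡ O.σ y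
      σ′≡σ {y} y∈ y∈′ σy≢h₀ σy≢v₁ = σ′-from y∈′ (∈∉⇒≢ y∈′ h₀∉B′) (∈∉⇒≢ y∈ v₀∉B)
        (hits-transfer (O.emit-inside {y} (proj₁ (bl.sound y∈))) (old-hits y∈) σy≢h₀ σy≢v₁)

      module _ {d : Bool} (cell-parity : even (k + c) ≡ d) where

        p-path : N.Steps (O.emit p) (beam k c d true true)
        p-path = steps-transfer (arrival-h₀ cell-parity (O.emit-inside {p} bp) (O.emit-parity {p} bp)
                                  (subst (O.Hits (O.emit p)) σp≡h₀ (old-hits p∈B)))
                 ◅◅ (into-cell-from-below d ◅ ε)
          where
          bp : O.isBoundary p ≡ true
          bp = proj₁ (bl.sound p∈B)

        q-path : N.Steps (O.emit q) (beam k c false d false)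
        q-path = steps-transfer (arrival-v₁ cell-parity (O.emit-inside {q} bq) (O.emit-parity {q} bq)
                                  (subst (O.Hits (O.emit q)) σq≡v₁ (old-hits q∈B)))
                 ◅◅ (into-cell-from-right d ◅ ε)
          where
          bq : O.isBoundary q ≡ true
          bq = proj₁ (bl.sound q∈B)

        via-v₁ : N.Hits (beam k c true d true) (O.σ v₁)
        via-v₁ = N.steps-hits (cell-to-right d ◅ ε) (subst (λ t → N.Hits t (O.σ v₁)) (emit-v₁ cell-parity)
                   (hits-transfer (O.emit-inside {v₁} v₁-boundary) (O.σ-hits {v₁} v₁-boundary) σv₁≢h₀ σv₁≢v₁))

        via-h₀ : N.Hits (beam k c d false false) (O.σ h₀)
        via-h₀ = N.steps-hits (cell-to-bottom d ◅ ε) (subst (λ t → N.Hits t (O.σ h₀)) (emit-h₀ cell-parity)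
                   (hits-transfer (O.emit-inside {h₀} h₀-boundary) (O.σ-hits {h₀} h₀-boundary) σh₀≢h₀ σh₀≢v₁))

        σ′h₁ : ∀ {e} → N.Hits (beam k c (not d) false true) e → N.σ h₁ ≡ e
        σ′h₁ {e} hits = N.σ-unique {h₁} h₁-boundary′ (subst (λ t → N.Hits t e) (sym (emit-h₁′ cell-parity)) hits)

        σ′v₀ : ∀ {e} → N.Hits (beam k c true (not d) false) e → N.σ v₀ ≡ e
        σ′v₀ {e} hits = N.σ-unique {v₀} v₀-boundary′ (subst (λ t → N.Hits t e) (sym (emit-v₀′ cell-parity)) hits)

      to-v₀ : ∀ dy′ → N.Hits (beam k c false dy′ true) v₀
      to-v₀ dy′ = _ , ε , cell-to-left dy′

      to-h₁ : ∀ dx′ → N.Hits (beam k c dx′ true false) h₁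
      to-h₁ dx′ = _ , ε , cell-to-top dx′

      -- the beams through the new cell turn towards v₁ or v₀ according to its parity
      splice : ∀ d → even (k + c) ≡ d → Splice O.σ N.σ B B′
      splice true cell-parity = record
        { a₁ = h₀ ; a₂ = v₁ ; b₁ = h₁ ; b₂ = v₀ ; p₁ = p ; p₂ = q
        ; a₁∈B = h₀∈B ; a₂∈B = v₁∈B ; b₁∈B′ = h₁∈B′ ; b₂∈B′ = v₀∈B′
        ; a₁∉B′ = h₀∉B′ ; a₂∉B′ = v₁∉B′ ; b₁∉B = h₁∉B ; b₂∉B = v₀∉B
        ; B⊆B′ = B⊆B′ ; B′⊆B = B′⊆B
        ; p₁∈B = p∈B ; p₂∈B = q∈B ; σp₁ = σp≡h₀ ; σp₂ = σq≡v₁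
        ; σa₂≢a₁ = σv₁≢h₀ ; σa₂≢a₂ = σv₁≢v₁
        ; σ′p₁ = σ′-from p∈B′ p≢h₀ (∈∉⇒≢ p∈B v₀∉B) (N.steps-hits (p-path cell-parity) (via-v₁ cell-parity))
        ; σ′p₂ = σ′-from q∈B′ q≢h₀ (∈∉⇒≢ q∈B v₀∉B) (N.steps-hits (q-path cell-parity) (to-h₁ false))
        ; σ′b₁ = σ′h₁ cell-parity (to-v₀ false)
        ; σ′b₂ = σ′v₀ cell-parity (via-h₀ cell-parity)
        ; σ′≡σ = σ′≡σ
        }
      splice false cell-parity = record
        { a₁ = v₁ ; a₂ = h₀ ; b₁ = v₀ ; b₂ = h₁ ; p₁ = q ; p₂ = p
        ; a₁∈B = v₁∈B ; a₂∈B = h₀∈B ; b₁∈B′ = v₀∈B′ ; b₂∈B′ = h₁∈B′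
        ; a₁∉B′ = v₁∉B′ ; a₂∉B′ = h₀∉B′ ; b₁∉B = v₀∉B ; b₂∉B = h₁∉B
        ; B⊆B′ = λ z∈ z≢v₁ z≢h₀ → B⊆B′ z∈ z≢h₀ z≢v₁
        ; B′⊆B = λ z∈ z≢v₀ z≢h₁ → B′⊆B z∈ z≢h₁ z≢v₀
        ; p₁∈B = q∈B ; p₂∈B = p∈B ; σp₁ = σq≡v₁ ; σp₂ = σp≡h₀
        ; σa₂≢a₁ = σh₀≢v₁ ; σa₂≢a₂ = σh₀≢h₀
        ; σ′p₁ = σ′-from q∈B′ q≢h₀ (∈∉⇒≢ q∈B v₀∉B) (N.steps-hits (q-path cell-parity) (via-h₀ cell-parity))
        ; σ′p₂ = σ′-from p∈B′ p≢h₀ (∈∉⇒≢ p∈B v₀∉B) (N.steps-hits (p-path cell-parity) (to-v₀ true))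
        ; σ′b₁ = σ′v₀ cell-parity (to-h₁ true)
        ; σ′b₂ = σ′h₁ cell-parity (via-v₁ cell-parity)
        ; σ′≡σ = λ y∈ y∈′ σy≢v₁ σy≢h₀ → σ′≡σ y∈ y∈′ σy≢h₀ σy≢v₁
        }

    cycles-add-cell : cycles N.σ B′ ~₁ cycles O.σ B
    cycles-add-cell = cycles-splice bl.unique bl′.unique perm perm′ (splice (even (k + c)) refl)

-- Dyck paths

#N #E : Path → ℕ
#N []      = 0
#N (N ∷ w) = suc (#N w)
#N (E ∷ w) = #N w
#E []      = 0
#E (N ∷ w) = #E w
#E (E ∷ w) = suc (#E w)

length≡#N+#E : ∀ w → length w ≡ #N w + #E w
length≡#N+#E []      = refl
length≡#N+#E (N ∷ w) = cong suc (length≡#N+#E w)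
length≡#N+#E (E ∷ w) = trans (cong suc (length≡#N+#E w)) (sym (+-suc (#N w) (#E w)))

dyck-balance : ∀ {h} w → DyckFrom h w → h + #N w ≡ #E w
dyck-balance         []      refl = +-identityʳ _
dyck-balance {h}     (N ∷ w) d    = trans (+-suc h (#N w)) (dyck-balance w d)
dyck-balance {suc h} (E ∷ w) d    = cong suc (dyck-balance w d)

dyck-split : ∀ {h} u {w} → DyckFrom h (u ++ w) → ∃ λ h′ → h′ + #E u ≡ h + #N u × DyckFrom h′ w
dyck-split {h} [] d = h , refl , d
dyck-split {h} (N ∷ u) d with h′ , eq , d′ ← dyck-split u d = h′ , trans eq (sym (+-suc h (#N u))) , d′
dyck-split {suc h} (E ∷ u) d with h′ , eq , d′ ← dyck-split u d = h′ , trans (+-suc h′ (#E u)) (cong suc eq) , d′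

double-injective : ∀ {a b} → a + a ≡ b + b → a ≡ b
double-injective {a} {b} eq with <-cmp a b
... | tri< a<b _ _ = ⊥-elim (<-irrefl eq (+-mono-< a<b a<b))
... | tri≈ _ a≡b _ = a≡b
... | tri> _ _ b<a = ⊥-elim (<-irrefl (sym eq) (+-mono-< b<a b<a))

dyck-#N : ∀ {n P} → IsDyck n P → #N P ≡ n
dyck-#N {n} {P} (len , d) =
  double-injective (trans (cong (#N P +_) (dyck-balance P d)) (trans (sym (length≡#N+#E P)) len))

heights-++ : ∀ h u w → heightsFrom h (u ++ w) ≡ heightsFrom h u ++ heightsFrom (h + #N u) w
heights-++ h []      w = cong (λ t → heightsFrom t w) (sym (+-identityʳ h))
heights-++ h (N ∷ u) w = trans (heights-++ (suc h) u w) (cong (λ t → heightsFrom (suc h) u ++ heightsFrom t w) (sym (+-suc h (#N u))))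
heights-++ h (E ∷ u) w = cong (h ∷_) (heights-++ h u w)

length-heights : ∀ h w → length (heightsFrom h w) ≡ #E w
length-heights h []      = refl
length-heights h (N ∷ w) = length-heights (suc h) w
length-heights h (E ∷ w) = cong suc (length-heights h w)

heights-≤ : ∀ h w → All (_≤ h + #N w) (heightsFrom h w)
heights-≤ h []      = []
heights-≤ h (N ∷ w) = subst (λ t → All (_≤ t) (heightsFrom (suc h) w)) (sym (+-suc h (#N w))) (heights-≤ (suc h) w)
heights-≤ h (E ∷ w) = m≤m+n h (#N w) ∷ heights-≤ h w

heights-≥ : ∀ h w → All (h ≤_) (heightsFrom h w)
heights-≥ h []      = []
heights-≥ h (N ∷ w) = All.map (≤-trans (n≤1+n h)) (heights-≥ (suc h) w)
heights-≥ h (E ∷ w) = ≤-refl ∷ heights-≥ h w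

nth-≤ : ∀ {m xs} → All (_≤ m) xs → ∀ i → nth xs i ≤ m
nth-≤ []       i       = z≤n
nth-≤ (p ∷ ps) zero    = p
nth-≤ (p ∷ ps) (suc i) = nth-≤ ps i

nth-++ˡ : ∀ xs {ys} i → i < length xs → nth (xs ++ ys) i ≡ nth xs i
nth-++ˡ (x ∷ xs) zero    _         = refl
nth-++ˡ (x ∷ xs) (suc i) (s≤s i<) = nth-++ˡ xs i i<

nth-++-after : ∀ xs {y zs} → nth (xs ++ y ∷ zs) (suc (length xs)) ≡ nth zs 0
nth-++-after []       = refl
nth-++-after (x ∷ xs) = nth-++-after xs

nth-++-∷ : ∀ xs {y y′ zs} i → i ≢ length xs → nth (xs ++ y ∷ zs) i ≡ nth (xs ++ y′ ∷ zs) i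
nth-++-∷ []       zero    i≢ = ⊥-elim (i≢ refl)
nth-++-∷ []       (suc i) _  = refl
nth-++-∷ (x ∷ xs) zero    _  = refl
nth-++-∷ (x ∷ xs) (suc i) i≢ = nth-++-∷ xs i (i≢ ∘ cong suc)

nth-++-length : ∀ xs {y zs} → nth (xs ++ y ∷ zs) (length xs) ≡ y
nth-++-length []       = refl
nth-++-length (x ∷ xs) = nth-++-length xs

nth-All : ∀ {P : ℕ → Set} {xs} → All P xs → ∀ {i} → i < length xs → P (nth xs i)
nth-All (p ∷ _)  {zero}  _         = p
nth-All (_ ∷ ps) {suc i} (s≤s i<) = nth-All ps i<

<ᵇ-true : ∀ {m n} → m < n → (m <ᵇ n) ≡ true
<ᵇ-true {m} {n} = dec-true (m <? n)

<ᵇ-false : ∀ {m n} → ¬ m < n → (m <ᵇ n) ≡ false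
<ᵇ-false {m} {n} = dec-false (m <? n)

NⁿEⁿ : ℕ → Path
NⁿEⁿ n = replicate n N ++ replicate n E

lo-NⁿEⁿ : ∀ n P i → Polygon.lo n P (NⁿEⁿ n) i ≡ 0
lo-NⁿEⁿ n P i = n≤0⇒n≡0 (nth-≤ (on-axis n) i)
  where
  only-N : ∀ h m → All (_≤ 0) (heightsFrom h (reflect (replicate m E)))
  only-N h zero    = []
  only-N h (suc m) = only-N (suc h) m
  on-axis : ∀ m → All (_≤ 0) (heightsFrom 0 (reflect (replicate m N ++ replicate n E)))
  on-axis zero    = only-N 0 n
  on-axis (suc m) = z≤n ∷ on-axis m

inside-NⁿEⁿ : ∀ n P i j → Polygon.inside n P (NⁿEⁿ n) i j ≡ (i <ᵇ n) ∧ (j <ᵇ nth (heights P) i)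
inside-NⁿEⁿ n P i j rewrite lo-NⁿEⁿ n P i = refl

dyck-inside⇒< : ∀ {n P} → IsDyck n P → ∀ {i j} → Polygon.inside n P (NⁿEⁿ n) i j ≡ true → i < n × j < n
dyck-inside⇒< {n} {P} dyck {i} {j} in≡
  with i<n , j<h ← Equivalence.to T-∧ (subst T (sym (trans (sym (inside-NⁿEⁿ n P i j)) in≡)) _) =
  <ᵇ⇒< i n i<n ,
  <-≤-trans (<ᵇ⇒< j _ j<h) (subst (nth (heights P) i ≤_) (dyck-#N {n} {P} dyck) (nth-≤ (heights-≤ 0 P) i))

<ᵇ-suc : ∀ j m → j ≢ m → (j <ᵇ suc m) ≡ (j <ᵇ m)
<ᵇ-suc zero    zero    j≢m = ⊥-elim (j≢m refl)
<ᵇ-suc zero    (suc m) _   = refl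
<ᵇ-suc (suc j) zero    _   = <ᵇ-false {suc j} {1} λ { (s≤s ()) }
<ᵇ-suc (suc j) (suc m) j≢m = <ᵇ-suc j m (j≢m ∘ cong suc)

module _ {n : ℕ} {P P′ : Path} {xs ys : List ℕ} {b : ℕ}
  (heights-P : heights P ≡ xs ++ suc b ∷ ys) (heights-P′ : heights P′ ≡ xs ++ suc (suc b) ∷ ys) where

  private
    k : ℕ
    k = length xs

    inside-P : ∀ i j → Polygon.inside n P (NⁿEⁿ n) i j ≡ (i <ᵇ n) ∧ (j <ᵇ nth (xs ++ suc b ∷ ys) i)
    inside-P i j = trans (inside-NⁿEⁿ n P i j) (cong (λ hs → (i <ᵇ n) ∧ (j <ᵇ nth hs i)) heights-P)

    inside-P′ : ∀ i j → Polygon.inside n P′ (NⁿEⁿ n) i j ≡ (i <ᵇ n) ∧ (j <ᵇ nth (xs ++ suc (suc b) ∷ ys) i)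
    inside-P′ i j = trans (inside-NⁿEⁿ n P′ i j) (cong (λ hs → (i <ᵇ n) ∧ (j <ᵇ nth hs i)) heights-P′)

    at : ∀ {i j h} → nth (xs ++ suc b ∷ ys) i ≡ h → Polygon.inside n P (NⁿEⁿ n) i j ≡ (i <ᵇ n) ∧ (j <ᵇ h)
    at {i} {j} eq = trans (inside-P i j) (cong (λ t → (i <ᵇ n) ∧ (j <ᵇ t)) eq)

  column-raised : All (_≤ suc b) xs → suc b < nth ys 0 → suc k < n →
                  CellAdded (Polygon.inside n P (NⁿEⁿ n)) (Polygon.inside n P′ (NⁿEⁿ n)) k b
  column-raised xs≤ ys-head sk<n = record
    { unchanged = unchanged
    ; cell-out  = trans (column {suc b}) (<ᵇ-false {suc b} {suc b} (<-irrefl refl))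
    ; cell-in′  = trans (inside-P′ k (suc b)) (cong₂ _∧_ k<ᵇn
                    (trans (cong (suc b <ᵇ_) (nth-++-length xs)) (<ᵇ-true {suc b} {suc (suc b)} ≤-refl)))
    ; below-in  = trans (column {b}) (<ᵇ-true {b} {suc b} ≤-refl)
    ; right-in  = trans (at (nth-++-after xs)) (cong₂ _∧_ (<ᵇ-true sk<n) (<ᵇ-true ys-head))
    ; above-out = trans (column {suc (suc b)}) (<ᵇ-false {suc (suc b)} {suc b} (λ lt → <-asym lt (n<1+n (suc b))))
    ; left-out  = λ {k′} k≡ → trans (at (nth-++ˡ xs k′ (subst (k′ <_) (sym k≡) (n<1+n k′))))
                    (trans (cong ((k′ <ᵇ n) ∧_) (<ᵇ-false (λ lt → <-irrefl refl (<-≤-trans lt (nth-≤ xs≤ k′)))))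
                           (∧-zeroʳ _))
    }
    where
    k<ᵇn : (k <ᵇ n) ≡ true
    k<ᵇn = <ᵇ-true (<-trans (n<1+n k) sk<n)
    column : ∀ {j} → Polygon.inside n P (NⁿEⁿ n) k j ≡ (j <ᵇ suc b)
    column {j} = trans (at (nth-++-length xs)) (cong (_∧ (j <ᵇ suc b)) k<ᵇn)
    unchanged : ∀ {i j} → (i , j) ≢ (k , suc b) → Polygon.inside n P′ (NⁿEⁿ n) i j ≡ Polygon.inside n P (NⁿEⁿ n) i j
    unchanged {i} {j} ij≢ rewrite inside-P i j | inside-P′ i j with i ≟ k
    ... | no i≢k    = cong (λ t → (i <ᵇ n) ∧ (j <ᵇ t)) (nth-++-∷ xs i i≢k)
    ... | yes refl rewrite nth-++-length xs {suc b} {ys} | nth-++-length xs {suc (suc b)} {ys} =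
      cong ((i <ᵇ n) ∧_) (<ᵇ-suc j (suc b) (λ { refl → ij≢ refl }))

-- the added cell is (#E u , #N u)
valley-adds-cell : ∀ {n} u v → IsDyck n (u ++ E ∷ N ∷ v) →
  ∃ λ k → ∃ λ b →
    CellAdded (Polygon.inside n (u ++ E ∷ N ∷ v) (NⁿEⁿ n)) (Polygon.inside n (u ++ N ∷ E ∷ v) (NⁿEⁿ n)) k b
valley-adds-cell {n} u v dyck@(_ , d) with dyck-split u d
... | suc h , h+k≡b , d′ = _ , _ , column-raised {n} {u ++ E ∷ N ∷ v} {u ++ N ∷ E ∷ v} heights-P heights-P′ xs≤ ys-head sk<n
  where
  b : ℕ
  b = h + #E u
  xs ys : List ℕ
  xs = heights u
  ys = heightsFrom (suc (suc b)) v
  heights-P : heights (u ++ E ∷ N ∷ v) ≡ xs ++ suc b ∷ ys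
  heights-P = subst (λ t → heights (u ++ E ∷ N ∷ v) ≡ xs ++ t ∷ heightsFrom (suc t) v) (sym h+k≡b)
                    (heights-++ 0 u (E ∷ N ∷ v))
  heights-P′ : heights (u ++ N ∷ E ∷ v) ≡ xs ++ suc (suc b) ∷ ys
  heights-P′ = subst (λ t → heights (u ++ N ∷ E ∷ v) ≡ xs ++ suc t ∷ heightsFrom (suc t) v) (sym h+k≡b)
                     (heights-++ 0 u (N ∷ E ∷ v))
  xs≤ : All (_≤ suc b) xs
  xs≤ = subst (λ t → All (_≤ t) xs) (sym h+k≡b) (heights-≤ 0 u)
  ys≢[] : 0 < length ys
  ys≢[] = subst (0 <_) (sym (trans (length-heights (suc (suc b)) v) (sym (dyck-balance v d′)))) (s≤s z≤n)
  ys-head : suc b < nth ys 0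
  ys-head = nth-All (heights-≥ (suc (suc b)) v) ys≢[]
  length≡n : length xs + suc (length ys) ≡ n
  length≡n = begin
    length xs + suc (length ys)        ≡⟨ length-++ xs ⟨
    length (xs ++ suc b ∷ ys)          ≡⟨ cong length heights-P ⟨
    length (heights (u ++ E ∷ N ∷ v))  ≡⟨ length-heights 0 (u ++ E ∷ N ∷ v) ⟩
    #E (u ++ E ∷ N ∷ v)                ≡⟨ dyck-balance (u ++ E ∷ N ∷ v) d ⟨
    #N (u ++ E ∷ N ∷ v)                ≡⟨ dyck-#N {n} {u ++ E ∷ N ∷ v} dyck ⟩
    n                                  ∎
    where open ≡-Reasoning
  sk<n : suc (length xs) < n
  sk<n = subst (suc (length xs) <_) length≡n
           (≤-trans (≤-reflexive (+-comm 2 (length xs))) (+-monoʳ-≤ (length xs) (s≤s ys≢[])))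

concatMap-map : ∀ {X Y Z : Set} (f : X → Y → Z) xs ys → concatMap (λ x → map (f x) ys) xs ≡ cartesianProductWith f xs ys
concatMap-map f []       ys = refl
concatMap-map f (x ∷ xs) ys = cong (map (f x) ys ++_) (concatMap-map f xs ys)

module Correspondence (n : ℕ) (P Q : Path)
  (inside⇒< : ∀ {i j} → Polygon.inside n P Q i j ≡ true → i < n × j < n) where

  private
    module Poly = Polygon n P Q
  module B = Billiard n Poly.inside inside⇒<

  toEdge : Poly.Edge → Edge
  toEdge (Poly.hor i j) = hor i j
  toEdge (Poly.ver i j) = ver i j

  fromEdge : Edge → Poly.Edge
  fromEdge (hor i j) = Poly.hor i j
  fromEdge (ver i j) = Poly.ver i j

  toEdge-fromEdge : ∀ z → toEdge (fromEdge z) ≡ z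
  toEdge-fromEdge (hor i j) = refl
  toEdge-fromEdge (ver i j) = refl

  toEdge-injective : ∀ {e e′} → toEdge e ≡ toEdge e′ → e ≡ e′
  toEdge-injective {Poly.hor _ _} {Poly.hor _ _} refl = refl
  toEdge-injective {Poly.ver _ _} {Poly.ver _ _} refl = refl

  toBeam : Poly.Beam → Beam
  toBeam (Poly.beam i j dx dy hz) = beam i j dx dy hz

  toOutcome : Poly.Next → Outcome
  toOutcome (Poly.hit e)  = hit (toEdge e)
  toOutcome (Poly.move b) = move (toBeam b)

  toOutcome-if : ∀ c x y → toOutcome (if c then x else y) ≡ (if c then toOutcome x else toOutcome y)
  toOutcome-if true  _ _ = refl
  toOutcome-if false _ _ = refl

  advance-corr : ∀ b → toOutcome (Poly.advance b) ≡ B.advance (toBeam b)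
  advance-corr (Poly.beam i       j       true  dy    true)  = toOutcome-if (Poly.inside (suc i) j) _ _
  advance-corr (Poly.beam zero    j       false dy    true)  = refl
  advance-corr (Poly.beam (suc i) j       false dy    true)  = toOutcome-if (Poly.inside i j) _ _
  advance-corr (Poly.beam i       j       true  true  false) = toOutcome-if (Poly.inside i (suc j)) _ _
  advance-corr (Poly.beam zero    j       false true  false) = toOutcome-if (Poly.inside zero (suc j)) _ _
  advance-corr (Poly.beam (suc i) j       false true  false) = toOutcome-if (Poly.inside (suc i) (suc j)) _ _
  advance-corr (Poly.beam i       zero    true  false false) = refl
  advance-corr (Poly.beam zero    zero    false false false) = refl
  advance-corr (Poly.beam (suc i) zero    false false false) = refl
  advance-corr (Poly.beam i       (suc j) true  false false) = toOutcome-if (Poly.inside i j) _ _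
  advance-corr (Poly.beam zero    (suc j) false false false) = toOutcome-if (Poly.inside zero j) _ _
  advance-corr (Poly.beam (suc i) (suc j) false false false) = toOutcome-if (Poly.inside (suc i) j) _ _

  travel-corr : ∀ k d b → toEdge (Poly.travel k d b) ≡ B.travel k (toEdge d) (toBeam b)
  travel-corr zero    d b = refl
  travel-corr (suc k) d b with Poly.advance b | advance-corr b
  ... | Poly.hit e   | eq rewrite sym eq = refl
  ... | Poly.move b′ | eq rewrite sym eq = travel-corr k d b′

  even-corr : ∀ m → Poly.even m ≡ even m
  even-corr zero    = refl
  even-corr (suc m) = cong not (even-corr m)

  emit-corr : ∀ e → toBeam (Poly.emit e) ≡ B.emit (toEdge e)
  emit-corr (Poly.hor i j) rewrite even-corr (i + j) with Poly.inside i j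
  ... | true  = refl
  ... | false = refl
  emit-corr (Poly.ver i j) rewrite even-corr (i + j) with Poly.inside i j
  ... | true  = refl
  ... | false = refl

  σ-corr : ∀ e → toEdge (Poly.σ e) ≡ B.σ (toEdge e)
  σ-corr e = trans (travel-corr _ e (Poly.emit e)) (cong (B.travel _ (toEdge e)) (emit-corr e))

  iter-corr : ∀ m e → toEdge (Poly.iter m e) ≡ iter B.σ m (toEdge e)
  iter-corr zero    e = refl
  iter-corr (suc m) e = trans (σ-corr (Poly.iter m e)) (cong B.σ (iter-corr m e))

  ⊑-corr : ∀ e e′ → (e Poly.≤ᴱ e′) ≡ (toEdge e ⊑ toEdge e′)
  ⊑-corr (Poly.hor _ _) (Poly.hor _ _) = refl
  ⊑-corr (Poly.hor _ _) (Poly.ver _ _) = refl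
  ⊑-corr (Poly.ver _ _) (Poly.hor _ _) = refl
  ⊑-corr (Poly.ver _ _) (Poly.ver _ _) = refl

  cycleRep-corr : ∀ L e → all (λ m → e Poly.≤ᴱ Poly.iter m e) (upTo L) ≡ isCycleRep B.σ L (toEdge e)
  cycleRep-corr L e = cong and (map-cong (λ m → trans (⊑-corr e (Poly.iter m e)) (cong (toEdge e ⊑_) (iter-corr m e))) (upTo L))

  count-map : ∀ (p : Poly.Edge → Bool) (q : Edge → Bool) → (∀ e → p e ≡ q (toEdge e)) →
              ∀ es → length (filter (T? ∘ p) es) ≡ count q (map toEdge es)
  count-map p q p≗q []       = refl
  count-map p q p≗q (e ∷ es) with p e | q (toEdge e) | p≗q e | count-map p q p≗q es
  ... | true  | .true  | refl | ih = cong suc ih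
  ... | false | .false | refl | ih = ih

  traj₂≡cycles : traj₂ n P Q ≡ cycles B.σ (map toEdge Poly.boundary)
  traj₂≡cycles = trans (count-map _ _ (cycleRep-corr (length Poly.boundary)) Poly.boundary)
                       (cong (λ L → count (isCycleRep B.σ L) (map toEdge Poly.boundary)) (sym (length-map toEdge Poly.boundary)))

  isBoundary-corr : ∀ e → Poly.isBoundary e ≡ B.isBoundary (toEdge e)
  isBoundary-corr (Poly.hor i zero)    = refl
  isBoundary-corr (Poly.hor i (suc j)) = refl
  isBoundary-corr (Poly.ver zero j)    = refl
  isBoundary-corr (Poly.ver (suc i) j) = refl

  private
    horizontals verticals : List Poly.Edge
    horizontals = cartesianProductWith Poly.hor (upTo n) (upTo (suc n))
    verticals   = cartesianProductWith Poly.ver (upTo (suc n)) (upTo n)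

    candidates≡ : concatMap (λ i → map (Poly.hor i) (upTo (suc n))) (upTo n)
                  ++ concatMap (λ i → map (Poly.ver i) (upTo n)) (upTo (suc n)) ≡ horizontals ++ verticals
    candidates≡ = cong₂ _++_ (concatMap-map Poly.hor (upTo n) (upTo (suc n))) (concatMap-map Poly.ver (upTo (suc n)) (upTo n))

    candidates-unique : Unique (horizontals ++ verticals)
    candidates-unique = Unique.++⁺
      (Unique.cartesianProductWith⁺ Poly.hor (λ { refl → refl , refl }) (Unique.upTo⁺ n) (Unique.upTo⁺ (suc n)))
      (Unique.cartesianProductWith⁺ Poly.ver (λ { refl → refl , refl }) (Unique.upTo⁺ (suc n)) (Unique.upTo⁺ n))
      disjoint
      where
      disjoint : ∀ {e} → ¬ (e ∈ horizontals × e ∈ verticals)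
      disjoint (e∈h , e∈v)
        with _ , _ , _ , _ , refl ← ∈-cartesianProductWith⁻ Poly.hor (upTo n) (upTo (suc n)) e∈h
        with _ , _ , _ , _ , ()   ← ∈-cartesianProductWith⁻ Poly.ver (upTo (suc n)) (upTo n) e∈v

    boundary≡ : Poly.boundary ≡ filter (T? ∘ Poly.isBoundary) (horizontals ++ verticals)
    boundary≡ = cong (filter (T? ∘ Poly.isBoundary)) candidates≡

    candidates-inGrid : ∀ {e} → e ∈ horizontals ++ verticals → InGrid n (toEdge e)
    candidates-inGrid e∈ with ∈-++⁻ horizontals e∈
    ... | inj₁ e∈h with _ , _ , i∈ , j∈ , refl ← ∈-cartesianProductWith⁻ Poly.hor (upTo n) (upTo (suc n)) e∈h =
      ∈-upTo⁻ i∈ , ≤-pred (∈-upTo⁻ j∈)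
    ... | inj₂ e∈v with _ , _ , i∈ , j∈ , refl ← ∈-cartesianProductWith⁻ Poly.ver (upTo (suc n)) (upTo n) e∈v =
      ≤-pred (∈-upTo⁻ i∈) , ∈-upTo⁻ j∈

    inGrid-candidates : ∀ z → InGrid n z → fromEdge z ∈ horizontals ++ verticals
    inGrid-candidates (hor i j) (i<n , j≤n) =
      ∈-++⁺ˡ (∈-cartesianProductWith⁺ Poly.hor (∈-upTo⁺ i<n) (∈-upTo⁺ (s≤s j≤n)))
    inGrid-candidates (ver i j) (i≤n , j<n) =
      ∈-++⁺ʳ horizontals (∈-cartesianProductWith⁺ Poly.ver (∈-upTo⁺ (s≤s i≤n)) (∈-upTo⁺ j<n))

  boundaryList : B.BoundaryList (map toEdge Poly.boundary)
  boundaryList = record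
    { unique   = Unique.map⁺ toEdge-injective (subst Unique (sym boundary≡) (Unique.filter⁺ _ candidates-unique))
    ; sound    = sound
    ; complete = complete
    }
    where
    sound : ∀ {z} → z ∈ map toEdge Poly.boundary → B.isBoundary z ≡ true × InGrid n z
    sound z∈ with e , e∈ , refl ← ∈-map⁻ toEdge z∈
             with e∈c , isB ← ∈-filter⁻ (T? ∘ Poly.isBoundary) {xs = horizontals ++ verticals}
                                        (subst (_ ∈_) boundary≡ e∈) =
      trans (sym (isBoundary-corr e)) (Equivalence.to T-≡ isB) , candidates-inGrid e∈c
    complete : ∀ {z} → B.isBoundary z ≡ true → InGrid n z → z ∈ map toEdge Poly.boundary
    complete {z} isB grid = subst (_∈ map toEdge Poly.boundary) (toEdge-fromEdge z)
      (∈-map⁺ toEdge (subst (fromEdge z ∈_) (sym boundary≡)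
        (∈-filter⁺ (T? ∘ Poly.isBoundary) (inGrid-candidates z grid)
          (subst T (sym (trans (isBoundary-corr (fromEdge z)) (trans (cong B.isBoundary (toEdge-fromEdge z)) isB))) _))))

lemma3p4 : (n : ℕ) → 2 ≤ n → (P P' : Path) → IsDyck n P → IsDyck n P' →
    ValleyToPeak P P' →
    (traj n P ≡ suc (traj n P')) ⊎ (suc (traj n P) ≡ traj n P')
lemma3p4 n _ _ _ dyck dyck′ (u , v , refl , refl) with _ , _ , added ← valley-adds-cell {n} u v dyck =
  subst₂ _~₁_ (sym old.traj₂≡cycles) (sym new.traj₂≡cycles)
    (~₁-sym (AddCell.cycles-add-cell {n} old-bounded new-bounded added old.boundaryList new.boundaryList))
  where
  old-bounded : ∀ {i j} → Polygon.inside n (u ++ E ∷ N ∷ v) (NⁿEⁿ n) i j ≡ true → i < n × j < n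
  old-bounded = dyck-inside⇒< {n} {u ++ E ∷ N ∷ v} dyck
  new-bounded : ∀ {i j} → Polygon.inside n (u ++ N ∷ E ∷ v) (NⁿEⁿ n) i j ≡ true → i < n × j < n
  new-bounded = dyck-inside⇒< {n} {u ++ N ∷ E ∷ v} dyck′
  module old = Correspondence n (u ++ E ∷ N ∷ v) (NⁿEⁿ n) old-bounded
  module new = Correspondence n (u ++ N ∷ E ∷ v) (NⁿEⁿ n) new-bounded
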